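{- Let $G$ be a 2-connected outerplanar graph whose weak dual has exactly $n_\ell=2$ leaves. Then $Z(G)=2$.
   Context: $Z(G)$ is the zero forcing number: each vertex is blue or white; if a blue vertex $u$ has exactly one white neighbor $v$, then $v$ turns blue; a zero forcing set is an initial blue set that eventually makes all vertices blue, and $Z(G)$ is the minimum size of such a set. The weak dual of an outerplanar graph (with a fixed outerplanar embedding) has the bounded faces as vertices, two adjacent when they share an edge; for 2-connected outerplanar graphs it is a tree. -}

module Defs where

open import Data.Nat using (ℕ; _≤_)
open import Data.Bool using (Bool; T)
open import Data.Fin using (Fin; _<_)
open import Data.Fin.Subset using (Subset; _∈_; _∉_; ∣_∣)
open import Data.Fin.Permutation using (Permutation′; _⟨$⟩ʳ_)
open import Data.Product using (Σ; ∃; _×_; _,_)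
open import Data.Sum using (_⊎_)
open import Data.Empty using (⊥)
open import Relation.Nullary using (¬_)
open import Relation.Binary.PropositionalEquality using (_≡_; _≢_)

record Graph (n : ℕ) : Set where
  field
    adj    : Fin n → Fin n → Bool
    sym    : ∀ u v → adj u v ≡ adj v u
    irrefl : ∀ u → adj u u ≡ Data.Bool.false

open Graph public

_∼[_]_ : ∀ {n} → Fin n → Graph n → Fin n → Set
u ∼[ G ] v = T (adj G u v)

data WalkAvoiding {n} (G : Graph n) (x : Fin n) : Fin n → Fin n → Set where
  here : ∀ {u} → u ≢ x → WalkAvoiding G x u u
  step : ∀ {u w v} → u ≢ x → u ∼[ G ] w → WalkAvoiding G x w v →
         WalkAvoiding G x u v

data Walk {n} (G : Graph n) : Fin n → Fin n → Set where
  here : ∀ {u} → Walk G u u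
  step : ∀ {u w v} → u ∼[ G ] w → Walk G w v → Walk G u v

Connected : ∀ {n} → Graph n → Set
Connected G = ∀ u v → Walk G u v

TwoConnected : ∀ {n} → Graph n → Set
TwoConnected {n} G =
  (3 ≤ n) × Connected G ×
  (∀ x u v → u ≢ x → v ≢ x → WalkAvoiding G x u v)

-- Outerplanar embeddings: the vertices are placed on a circle in some
-- cyclic order (position p carries vertex  ord ⟨$⟩ʳ p ) and the edges,
-- drawn as straight chords, do not cross.

record OuterplanarEmbedding {n} (G : Graph n) : Set where
  field
    ord : Permutation′ n
  E : Fin n → Fin n → Set
  E p q = (ord ⟨$⟩ʳ p) ∼[ G ] (ord ⟨$⟩ʳ q)
  field
    noncrossing : ∀ p q r s → E p q → E r s →
                  p < r → r < q → q < s → ⊥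

open OuterplanarEmbedding public

-- Bounded faces of the embedding, identified by their sets of
-- boundary positions.

-- q follows p in the cyclic order of the positions in F
-- (no element of F strictly between them going around the circle)
CycSucc : ∀ {n} → Subset n → Fin n → Fin n → Set
CycSucc F p q =
  (p < q × (∀ r → r ∈ F → p < r → r < q → ⊥)) ⊎
  (q < p × (∀ r → r ∈ F → p < r → ⊥) × (∀ r → r ∈ F → r < q → ⊥))

Consecutive : ∀ {n} → Subset n → Fin n → Fin n → Set
Consecutive F p q = p ∈ F × q ∈ F × (CycSucc F p q ⊎ CycSucc F q p)

-- F is (the vertex set of) a bounded face: a polygon with at least 3
-- corners whose sides are edges of G and none of whose diagonals are
-- edges of G.  (For a non-crossing circular drawing these are exactly
-- the bounded faces.)
IsFace : ∀ {n} {G : Graph n} → OuterplanarEmbedding G → Subset n → Set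
IsFace e F =
  (3 ≤ ∣ F ∣) ×
  (∀ p q → Consecutive F p q → E e p q) ×
  (∀ p q → p ∈ F → q ∈ F → p ≢ q → E e p q → Consecutive F p q)

DualAdj : ∀ {n} {G : Graph n} → OuterplanarEmbedding G →
          Subset n → Subset n → Set
DualAdj e F F′ =
  IsFace e F × IsFace e F′ × F ≢ F′ ×
  ∃ λ p → ∃ λ q → p ≢ q × E e p q × Consecutive F p q × Consecutive F′ p q

IsLeaf : ∀ {n} {G : Graph n} → OuterplanarEmbedding G → Subset n → Set
IsLeaf e F =
  IsFace e F ×
  ∃ λ F′ → DualAdj e F F′ × (∀ F″ → DualAdj e F F″ → F″ ≡ F′)

ExactlyTwoLeaves : ∀ {n} {G : Graph n} → OuterplanarEmbedding G → Set
ExactlyTwoLeaves e =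
  ∃ λ L₁ → ∃ λ L₂ → IsLeaf e L₁ × IsLeaf e L₂ × L₁ ≢ L₂ ×
  (∀ L → IsLeaf e L → L ≡ L₁ ⊎ L ≡ L₂)

data Blue {n} (G : Graph n) (S : Subset n) : Fin n → Set where
  init  : ∀ {v} → v ∈ S → Blue G S v
  force : ∀ {u v} → Blue G S u → u ∼[ G ] v →
          (∀ w → u ∼[ G ] w → w ≢ v → Blue G S w) → Blue G S v

IsZeroForcingSet : ∀ {n} → Graph n → Subset n → Set
IsZeroForcingSet G S = ∀ v → Blue G S v

ZeroForcingNumberIs : ∀ {n} → Graph n → ℕ → Set
ZeroForcingNumberIs {n} G k =
  (∃ λ (S : Subset n) → ∣ S ∣ ≡ k × IsZeroForcingSet G S) ×
  (∀ (S : Subset n) → IsZeroForcingSet G S → k ≤ ∣ S ∣)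

{-# OPTIONS --safe #-}

-- In a non-crossing circular drawing of a 2-connected graph, consecutive positions are adjacent (otherwise
-- the outermost chord over the gap would end in a cut vertex).  So every vertex has two neighbours, and no
-- single blue vertex can ever force: Z(G) ≥ 2.  Conversely, colour the first and last position blue and
-- sweep inwards: an end forces its successor unless a chord leaves it into the unswept part, so the sweep
-- only stalls at two chords l–a and b–r of length at least 2 with a ≤ b.  Under every chord other than the
-- top edge lies a leaf of the weak dual, namely the face under an innermost chord.  After rotating the
-- drawing so that an outer edge of one leaf becomes the top edge, a stalled sweep would produce a further
-- leaf under each of l–a and b–r: three leaves, which the hypothesis excludes.

module Submission where

open import Defs hiding (sym)
open import Data.Nat as ℕ using (ℕ; zero; suc; _+_; _∸_; z≤n; s≤s; _≤_; _<_; _≤?_; _<?_)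
open import Data.Nat.Properties
open import Data.Fin using (Fin; zero; suc; toℕ; fromℕ<; fromℕ; inject₁; lower₁)
open import Data.Fin.Properties
  using (toℕ-injective; toℕ<n; toℕ-fromℕ<; toℕ-fromℕ; toℕ-inject₁; toℕ-lower₁; toℕ≤pred[n]; any?)
  renaming (_≟_ to _≟ᶠ_)
open import Data.Fin.Subset using (Subset; _∈_; _∉_; _⊆_; ∣_∣; ⁅_⁆; _∪_; inside; outside; Nonempty)
open import Data.Fin.Subset.Properties
  using (_∈?_; nonempty?; Empty-unique; ∣⊥∣≡0; ⊆-antisym; x∈p⇒∣p-x∣<∣p∣; x∈p∧x≢y⇒x∈p-y; x∈⁅x⁆; x∈p∪q⁺;
         p⊆q⇒∣p∣≤∣q∣; ∣⁅x⁆∣≡1)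
open import Data.Fin.Permutation using (Permutation′; _⟨$⟩ʳ_; _⟨$⟩ˡ_; inverseʳ; inverseˡ; permutation; _∘ₚ_)
open import Data.Vec using ([]; _∷_; tabulate; lookup)
open import Data.Vec.Properties using ([]=⇒lookup; lookup⇒[]=; lookup∘tabulate; tabulate∘lookup; tabulate-cong)
import Data.Bool as Bool
open import Data.Product using (∃; ∃₂; _×_; _,_; proj₁; proj₂) renaming (map to map-×)
open import Data.Sum using (_⊎_; inj₁; inj₂; [_,_]′) renaming (map to map-⊎)
open import Data.Empty using (⊥; ⊥-elim)
open import Relation.Nullary using (¬_; Dec; yes; no)
open import Relation.Nullary.Decidable using (_×-dec_; _⊎-dec_; ¬?; T?; does; decidable-stable; dec-true)
open import Relation.Unary using (Decidable)
open import Relation.Binary.PropositionalEquality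
open import Relation.Binary.Definitions using (tri<; tri≈; tri>)
open import Function using (_∘_)

greatest : ∀ {n} {P : Fin n → Set} → Decidable P → ∀ x → P x →
           ∃ λ y → P y × (∀ z → P z → toℕ z ≤ toℕ y)
greatest {suc n} P? x px with any? (P? ∘ suc)
... | yes (i , pi) with greatest (P? ∘ suc) i pi
...   | y , py , ymax = suc y , py , λ { zero _ → z≤n ; (suc z) pz → s≤s (ymax z pz) }
greatest {suc n} P? zero    px | no ¬∃ = zero , px , λ { zero _ → z≤n ; (suc z) pz → ⊥-elim (¬∃ (z , pz)) }
greatest {suc n} P? (suc x) px | no ¬∃ = ⊥-elim (¬∃ (x , px))

least : ∀ {n} {P : Fin n → Set} → Decidable P → ∀ x → P x →
        ∃ λ y → P y × (∀ z → P z → toℕ y ≤ toℕ z)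
least {suc n} P? x px with P? zero
... | yes p0 = zero , p0 , λ _ _ → z≤n
least {suc n} P? zero    px | no ¬p0 = ⊥-elim (¬p0 px)
least {suc n} P? (suc x) px | no ¬p0 with least (P? ∘ suc) x px
... | y , py , ymin = suc y , py , λ { zero pz → ⊥-elim (¬p0 pz) ; (suc z) pz → s≤s (ymin z pz) }

next : ∀ {n} {x y : Fin n} → toℕ x < toℕ y → ∃ λ (x′ : Fin n) → toℕ x′ ≡ suc (toℕ x)
next {y = y} x<y = fromℕ< (≤-<-trans x<y (toℕ<n y)) , toℕ-fromℕ< _

width-< : ∀ {u s t v} → u ≤ s → s ≤ t → t ≤ v → u < s ⊎ t < v → t ∸ s < v ∸ u
width-< {u} {s} {t} {v} us st tv (inj₁ u<s) = <-≤-trans (∸-monoʳ-< {t} u<s st) (∸-monoˡ-≤ u tv)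
width-< {u} {s} {t} {v} us st tv (inj₂ t<v) = <-≤-trans (∸-monoˡ-< t<v st) (∸-monoʳ-≤ v us)

Innermost : ∀ {n} → (Fin n → Fin n → Set) → Fin n → Fin n → Set
Innermost P p q = P p q × (∀ s t → P s t → toℕ p ≤ toℕ s → toℕ t ≤ toℕ q → s ≡ p × t ≡ q)

module _ {n} {P : Fin n → Fin n → Set} (P? : ∀ s t → Dec (P s t))
         (P⇒≤ : ∀ {s t} → P s t → toℕ s ≤ toℕ t) where

  private
    properly-inside : ∀ {u s t v : Fin n} → toℕ u ≤ toℕ s → toℕ t ≤ toℕ v → ¬ (s ≡ u × t ≡ v) →
                      toℕ u < toℕ s ⊎ toℕ t < toℕ v
    properly-inside us tv ne with m≤n⇒m<n∨m≡n us | m≤n⇒m<n∨m≡n tv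
    ... | inj₁ u<s | _        = inj₁ u<s
    ... | inj₂ _   | inj₁ t<v = inj₂ t<v
    ... | inj₂ u≡s | inj₂ t≡v = ⊥-elim (ne (toℕ-injective (sym u≡s) , toℕ-injective t≡v))

    innermost-within : ∀ k u v → toℕ v ∸ toℕ u ≤ k → P u v →
                       ∃ λ p → ∃ λ q → toℕ u ≤ toℕ p × toℕ q ≤ toℕ v × Innermost P p q
    innermost-within k u v w Puv
      with any? (λ s → any? λ t → P? s t ×-dec (toℕ u ≤? toℕ s) ×-dec (toℕ t ≤? toℕ v)
                                          ×-dec ¬? ((s ≟ᶠ u) ×-dec (t ≟ᶠ v)))
    ... | no none = u , v , ≤-refl , ≤-refl , Puv , λ s t Pst us tv →
          decidable-stable ((s ≟ᶠ u) ×-dec (t ≟ᶠ v)) (λ ne → none (s , t , Pst , us , tv , ne))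
    ... | yes (s , t , Pst , us , tv , ne) with k | width-< us (P⇒≤ Pst) tv (properly-inside us tv ne)
    ...   | zero   | narrower = ⊥-elim (<-irrefl refl (<-≤-trans narrower (≤-trans w z≤n)))
    ...   | suc k′ | narrower with innermost-within k′ s t (≤-pred (<-≤-trans narrower w)) Pst
    ...     | p , q , sp , qt , inn = p , q , ≤-trans us sp , ≤-trans qt tv , inn

  innermost : ∀ u v → P u v → ∃ λ p → ∃ λ q → toℕ u ≤ toℕ p × toℕ q ≤ toℕ v × Innermost P p q
  innermost u v = innermost-within _ u v ≤-refl

x∈p⇒1≤∣p∣ : ∀ {n} {p : Subset n} {x} → x ∈ p → 1 ≤ ∣ p ∣
x∈p⇒1≤∣p∣ x∈p = ≤-<-trans z≤n (x∈p⇒∣p-x∣<∣p∣ x∈p)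

x≢y⇒2≤∣p∣ : ∀ {n} {p : Subset n} {x y} → x ≢ y → x ∈ p → y ∈ p → 2 ≤ ∣ p ∣
x≢y⇒2≤∣p∣ x≢y x∈p y∈p =
  ≤-trans (s≤s (x∈p⇒1≤∣p∣ (x∈p∧x≢y⇒x∈p-y y∈p (x≢y ∘ sym)))) (x∈p⇒∣p-x∣<∣p∣ x∈p)

x≢y≢z⇒3≤∣p∣ : ∀ {n} {p : Subset n} {x y z} → x ≢ y → x ≢ z → y ≢ z →
              x ∈ p → y ∈ p → z ∈ p → 3 ≤ ∣ p ∣
x≢y≢z⇒3≤∣p∣ x≢y x≢z y≢z x∈p y∈p z∈p =
  ≤-trans (s≤s (x≢y⇒2≤∣p∣ y≢z (x∈p∧x≢y⇒x∈p-y y∈p (x≢y ∘ sym)) (x∈p∧x≢y⇒x∈p-y z∈p (x≢z ∘ sym))))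
          (x∈p⇒∣p-x∣<∣p∣ x∈p)

∣p∪q∣≤∣p∣+∣q∣ : ∀ {n} (p q : Subset n) → ∣ p ∪ q ∣ ≤ ∣ p ∣ + ∣ q ∣
∣p∪q∣≤∣p∣+∣q∣ []            []            = z≤n
∣p∪q∣≤∣p∣+∣q∣ (inside ∷ p)  (inside ∷ q)  =
  s≤s (≤-trans (∣p∪q∣≤∣p∣+∣q∣ p q) (≤-trans (n≤1+n _) (≤-reflexive (sym (+-suc ∣ p ∣ ∣ q ∣)))))
∣p∪q∣≤∣p∣+∣q∣ (inside ∷ p)  (outside ∷ q) = s≤s (∣p∪q∣≤∣p∣+∣q∣ p q)
∣p∪q∣≤∣p∣+∣q∣ (outside ∷ p) (inside ∷ q)  =
  ≤-trans (s≤s (∣p∪q∣≤∣p∣+∣q∣ p q)) (≤-reflexive (sym (+-suc ∣ p ∣ ∣ q ∣)))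
∣p∪q∣≤∣p∣+∣q∣ (outside ∷ p) (outside ∷ q) = ∣p∪q∣≤∣p∣+∣q∣ p q

∣⁅x⁆∪⁅y⁆∣≤2 : ∀ {n} (x y : Fin n) → ∣ ⁅ x ⁆ ∪ ⁅ y ⁆ ∣ ≤ 2
∣⁅x⁆∪⁅y⁆∣≤2 x y =
  ≤-trans (∣p∪q∣≤∣p∣+∣q∣ ⁅ x ⁆ ⁅ y ⁆) (≤-reflexive (cong₂ _+_ (∣⁅x⁆∣≡1 x) (∣⁅x⁆∣≡1 y)))

x≢y⇒∣⁅x⁆∪⁅y⁆∣≡2 : ∀ {n} {x y : Fin n} → x ≢ y → ∣ ⁅ x ⁆ ∪ ⁅ y ⁆ ∣ ≡ 2
x≢y⇒∣⁅x⁆∪⁅y⁆∣≡2 {x = x} {y} x≢y = ≤-antisym (∣⁅x⁆∪⁅y⁆∣≤2 x y)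
  (x≢y⇒2≤∣p∣ x≢y (x∈p∪q⁺ (inj₁ (x∈⁅x⁆ x))) (x∈p∪q⁺ (inj₂ (x∈⁅x⁆ y))))

1≤∣p∣⇒Nonempty : ∀ {n} {p : Subset n} → 1 ≤ ∣ p ∣ → Nonempty p
1≤∣p∣⇒Nonempty {n} {p} 1≤∣p∣ with nonempty? p
... | yes p≠∅ = p≠∅
... | no  p≡∅ = ⊥-elim (n≮0 (subst (1 ≤_) (trans (cong ∣_∣ (Empty-unique p≡∅)) (∣⊥∣≡0 n)) 1≤∣p∣))

3≤∣p∣⇒∃-third : ∀ {n} {p : Subset n} → 3 ≤ ∣ p ∣ → ∀ x y → ∃ λ z → z ∈ p × z ≢ x × z ≢ y
3≤∣p∣⇒∃-third {p = p} 3≤∣p∣ x y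
  with any? (λ z → (z ∈? p) ×-dec ¬? (z ≟ᶠ x) ×-dec ¬? (z ≟ᶠ y))
... | yes third = third
... | no none =
  ⊥-elim (<-irrefl refl (≤-<-trans 3≤∣p∣ (s≤s (≤-trans (p⊆q⇒∣p∣≤∣q∣ p⊆⁅x⁆∪⁅y⁆) (∣⁅x⁆∪⁅y⁆∣≤2 x y)))))
  where
  p⊆⁅x⁆∪⁅y⁆ : p ⊆ ⁅ x ⁆ ∪ ⁅ y ⁆
  p⊆⁅x⁆∪⁅y⁆ {z} z∈p with z ≟ᶠ x | z ≟ᶠ y
  ... | yes refl | _        = x∈p∪q⁺ (inj₁ (x∈⁅x⁆ z))
  ... | no _     | yes refl = x∈p∪q⁺ (inj₂ (x∈⁅x⁆ z))
  ... | no z≢x   | no z≢y   = ⊥-elim (none (z , z∈p , z≢x , z≢y))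

subsetOf : ∀ {n} {P : Fin n → Set} → Decidable P → Subset n
subsetOf P? = tabulate (does ∘ P?)

module _ {n} {P : Fin n → Set} (P? : Decidable P) where

  ∈subsetOf⁺ : ∀ {x} → P x → x ∈ subsetOf P?
  ∈subsetOf⁺ {x} px = lookup⇒[]= x _ (trans (lookup∘tabulate (does ∘ P?) x) (dec-true (P? x) px))

  ∈subsetOf⁻ : ∀ {x} → x ∈ subsetOf P? → P x
  ∈subsetOf⁻ {x} x∈ with P? x | trans (sym (lookup∘tabulate (does ∘ P?) x)) ([]=⇒lookup x∈)
  ... | yes px | _ = px
  ... | no _   | ()

abstract
  preimage : ∀ {n} → (Fin n → Fin n) → Subset n → Subset n
  preimage f F = tabulate (lookup F ∘ f)

  ∈preimage⁺ : ∀ {n} {f : Fin n → Fin n} {F i} → f i ∈ F → i ∈ preimage f F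
  ∈preimage⁺ {f = f} {F} {i} fi∈ = lookup⇒[]= i _ (trans (lookup∘tabulate (lookup F ∘ f) i) ([]=⇒lookup fi∈))

  ∈preimage⁻ : ∀ {n} {f : Fin n → Fin n} {F i} → i ∈ preimage f F → f i ∈ F
  ∈preimage⁻ {f = f} {F} {i} i∈ = lookup⇒[]= (f i) F (trans (sym (lookup∘tabulate (lookup F ∘ f) i)) ([]=⇒lookup i∈))

  preimage-id : ∀ {n} (F : Subset n) → preimage (λ i → i) F ≡ F
  preimage-id = tabulate∘lookup

  preimage-∘ : ∀ {n} (f g : Fin n → Fin n) F → preimage g (preimage f F) ≡ preimage (f ∘ g) F
  preimage-∘ f g F = tabulate-cong λ i → lookup∘tabulate (lookup F ∘ f) (g i)

  preimage-inverse : ∀ {n} {f g : Fin n → Fin n} → (∀ i → f (g i) ≡ i) → ∀ F → preimage g (preimage f F) ≡ F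
  preimage-inverse {f = f} {g} f∘g≗id F = trans
    (tabulate-cong λ i → trans (lookup∘tabulate (lookup F ∘ f) (g i)) (cong (lookup F) (f∘g≗id i)))
    (tabulate∘lookup F)

3≤∣preimage∣ : ∀ {n} {f g : Fin n → Fin n} → (∀ i → f (g i) ≡ i) → ∀ {F} → 3 ≤ ∣ F ∣ → 3 ≤ ∣ preimage f F ∣
3≤∣preimage∣ {f = f} {g} f∘g≗id {F} 3≤∣F∣ =
  let x , x∈ = 1≤∣p∣⇒Nonempty (≤-trans (s≤s z≤n) 3≤∣F∣)
      y , y∈ , y≢x , _ = 3≤∣p∣⇒∃-third 3≤∣F∣ x x
      z , z∈ , z≢x , z≢y = 3≤∣p∣⇒∃-third 3≤∣F∣ x y
      g-injective : ∀ {a b} → g a ≡ g b → a ≡ b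
      g-injective {a} {b} eq = trans (sym (f∘g≗id a)) (trans (cong f eq) (f∘g≗id b))
      ∈preimage : ∀ {a} → a ∈ F → g a ∈ preimage f F
      ∈preimage {a} a∈ = ∈preimage⁺ (subst (_∈ F) (sym (f∘g≗id a)) a∈)
  in x≢y≢z⇒3≤∣p∣ (y≢x ∘ sym ∘ g-injective) (z≢x ∘ sym ∘ g-injective) (z≢y ∘ sym ∘ g-injective)
                 (∈preimage x∈) (∈preimage y∈) (∈preimage z∈)

-- Circular drawings

Consecutive-sym : ∀ {n} {F : Subset n} {p q} → Consecutive F p q → Consecutive F q p
Consecutive-sym (p∈ , q∈ , inj₁ pq) = q∈ , p∈ , inj₂ pq
Consecutive-sym (p∈ , q∈ , inj₂ qp) = q∈ , p∈ , inj₁ qp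

module Drawing {n} {G : Graph n} (e : OuterplanarEmbedding G) where

  vertexAt positionOf : Fin n → Fin n
  vertexAt p = ord e ⟨$⟩ʳ p
  positionOf v = ord e ⟨$⟩ˡ v

  vertexAt-positionOf : ∀ v → vertexAt (positionOf v) ≡ v
  vertexAt-positionOf v = inverseʳ (ord e)

  positionOf-vertexAt : ∀ p → positionOf (vertexAt p) ≡ p
  positionOf-vertexAt p = inverseˡ (ord e)

  vertexAt-injective : ∀ {p q} → vertexAt p ≡ vertexAt q → p ≡ q
  vertexAt-injective {p} {q} eq =
    trans (sym (positionOf-vertexAt p)) (trans (cong positionOf eq) (positionOf-vertexAt q))

  E? : ∀ p q → Dec (E e p q)
  E? p q = T? (adj G (vertexAt p) (vertexAt q))

  E-sym : ∀ {p q} → E e p q → E e q p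
  E-sym {p} {q} = subst Bool.T (Graph.sym G (vertexAt p) (vertexAt q))

  E-irrefl : ∀ {p} → ¬ E e p p
  E-irrefl {p} = subst Bool.T (irrefl G (vertexAt p))

  ∼⇒E : ∀ {u v} → u ∼[ G ] v → E e (positionOf u) (positionOf v)
  ∼⇒E {u} {v} = subst₂ _∼[ G ]_ (sym (vertexAt-positionOf u)) (sym (vertexAt-positionOf v))

  crossing : ∀ {p q r s} → E e p q → E e r s →
             toℕ p < toℕ r → toℕ r < toℕ q → toℕ q < toℕ s → ⊥
  crossing = noncrossing e _ _ _ _

  nested : ∀ {a b c d z : Fin n} → E e a b → E e c d → toℕ a ≤ toℕ z → toℕ c ≤ toℕ z →
           toℕ z < toℕ b → toℕ z < toℕ d →
           (toℕ a ≤ toℕ c × toℕ d ≤ toℕ b) ⊎ (toℕ c ≤ toℕ a × toℕ b ≤ toℕ d)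
  nested {a} {b} {c} {d} Eab Ecd az cz zb zd with <-cmp (toℕ a) (toℕ c) | <-cmp (toℕ b) (toℕ d)
  ... | tri< a<c _ _ | tri< b<d _ _ = ⊥-elim (crossing Eab Ecd a<c (≤-<-trans cz zb) b<d)
  ... | tri< a<c _ _ | tri≈ _ b≡d _ = inj₁ (<⇒≤ a<c , ≤-reflexive (sym b≡d))
  ... | tri< a<c _ _ | tri> _ _ d<b = inj₁ (<⇒≤ a<c , <⇒≤ d<b)
  ... | tri≈ _ a≡c _ | tri< b<d _ _ = inj₂ (≤-reflexive (sym a≡c) , <⇒≤ b<d)
  ... | tri≈ _ a≡c _ | tri≈ _ b≡d _ = inj₁ (≤-reflexive a≡c , ≤-reflexive (sym b≡d))
  ... | tri≈ _ a≡c _ | tri> _ _ d<b = inj₁ (≤-reflexive a≡c , <⇒≤ d<b)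
  ... | tri> _ _ c<a | tri< b<d _ _ = inj₂ (<⇒≤ c<a , <⇒≤ b<d)
  ... | tri> _ _ c<a | tri≈ _ b≡d _ = inj₂ (<⇒≤ c<a , ≤-reflexive b≡d)
  ... | tri> _ _ c<a | tri> _ _ d<b = ⊥-elim (crossing Ecd Eab c<a (≤-<-trans az zd) d<b)

  walkAvoiding-confined : (A : Fin n → Set) (x : Fin n) → (∀ p q → A p → E e p q → A q ⊎ q ≡ x) →
                          ∀ {u v} → WalkAvoiding G (vertexAt x) u v → A (positionOf u) → A (positionOf v)
  walkAvoiding-confined A x closed (here _) a = a
  walkAvoiding-confined A x closed (step {w = w} _ u∼w rest) a with closed _ _ a (∼⇒E u∼w)
  ... | inj₁ aw   = walkAvoiding-confined A x closed rest aw
  ... | inj₂ w≡x = ⊥-elim (start-avoids rest (trans (sym (vertexAt-positionOf w)) (cong vertexAt w≡x)))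
    where
    start-avoids : ∀ {y u v} → WalkAvoiding G y u v → u ≢ y
    start-avoids (here u≢y)     = u≢y
    start-avoids (step u≢y _ _) = u≢y

  walk-steps-over : ∀ k {u v} → Walk G u v → toℕ (positionOf u) ≤ k → k < toℕ (positionOf v) →
                    ∃ λ s → ∃ λ t → toℕ s ≤ k × k < toℕ t × E e s t
  walk-steps-over k here u≤k k<v = ⊥-elim (<-irrefl refl (≤-<-trans u≤k k<v))
  walk-steps-over k (step {u} {w} u∼w rest) u≤k k<v with toℕ (positionOf w) ≤? k
  ... | yes w≤k = walk-steps-over k rest w≤k k<v
  ... | no  w≰k = positionOf u , positionOf w , u≤k , ≰⇒> w≰k , ∼⇒E u∼w

module OuterCycle {n} {G : Graph n} (e : OuterplanarEmbedding G) (2-conn : TwoConnected G) where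
  open Drawing e

  closure-avoiding : (A : Fin n → Set) (x : Fin n) → (∀ r s → A r → E e r s → A s ⊎ s ≡ x) →
                     ∀ {p q} → p ≢ x → q ≢ x → A p → A q
  closure-avoiding A x closed {p} {q} p≢x q≢x Ap =
    subst A (positionOf-vertexAt q)
      (walkAvoiding-confined A x closed
        (proj₂ (proj₂ 2-conn) (vertexAt x) (vertexAt p) (vertexAt q)
               (p≢x ∘ vertexAt-injective) (q≢x ∘ vertexAt-injective))
        (subst A (sym (positionOf-vertexAt p)) Ap))

  private
    SpansOver : Fin n → Fin n → Fin n → Set
    SpansOver p s t = toℕ s ≤ toℕ p × toℕ p < toℕ t × E e s t

    SpansOver? : ∀ p s t → Dec (SpansOver p s t)
    SpansOver? p s t = (toℕ s ≤? toℕ p) ×-dec (toℕ p <? toℕ t) ×-dec E? s t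

    outermost-span-starts-at : ∀ {p s t} → SpansOver p s t → (∀ s′ t′ → SpansOver p s′ t′ → toℕ s′ ≤ toℕ s) →
                               toℕ s ≡ toℕ p
    outermost-span-starts-at {p} {s} {t} (s≤p , p<t , Est) s-max with m≤n⇒m<n∨m≡n s≤p
    ... | inj₂ s≡p = s≡p
    ... | inj₁ s<p = ⊥-elim (<⇒≱ p<t (proj₂ (closure-avoiding A s closed (<⇒≢ s<p ∘ cong toℕ ∘ sym)
                                                 (<⇒≢ (<-trans s<p p<t) ∘ cong toℕ ∘ sym) (s<p , ≤-refl))))
      where
      A : Fin n → Set
      A x = toℕ s < toℕ x × toℕ x ≤ toℕ p
      closed : ∀ x w → A x → E e x w → A w ⊎ w ≡ s
      closed x w (s<x , x≤p) Exw with <-cmp (toℕ p) (toℕ w)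
      ... | tri< p<w _ _ = ⊥-elim (<⇒≱ s<x (s-max x w (x≤p , p<w , Exw)))
      ... | tri≈ _ p≡w _ = inj₁ (subst (toℕ s <_) p≡w s<p , ≤-reflexive (sym p≡w))
      ... | tri> _ _ w<p with <-cmp (toℕ w) (toℕ s)
      ...   | tri< w<s _ _ = ⊥-elim (crossing (E-sym Exw) Est w<s s<x (≤-<-trans x≤p p<t))
      ...   | tri≈ _ w≡s _ = inj₂ (toℕ-injective w≡s)
      ...   | tri> _ _ s<w = inj₁ (s<w , <⇒≤ w<p)

    shortest-span-from-p-ends-at-successor : ∀ {p q t} → toℕ q ≡ suc (toℕ p) → SpansOver p p t →
                                             (∀ t′ → SpansOver p p t′ → toℕ t ≤ toℕ t′) → t ≡ q
    shortest-span-from-p-ends-at-successor {p} {q} {t} q≡1+p (_ , p<t , Ept) t-min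
      with m≤n⇒m<n∨m≡n (subst (_≤ toℕ t) (sym q≡1+p) p<t)
    ... | inj₂ q≡t = toℕ-injective (sym q≡t)
    ... | inj₁ q<t = ⊥-elim (<-irrefl refl (proj₁ (closure-avoiding B t closed (<⇒≢ q<t ∘ cong toℕ)
                                                     (<⇒≢ p<t ∘ cong toℕ) (≤-reflexive (sym q≡1+p) , q<t))))
      where
      B : Fin n → Set
      B x = toℕ p < toℕ x × toℕ x < toℕ t
      closed : ∀ x w → B x → E e x w → B w ⊎ w ≡ t
      closed x w (p<x , x<t) Exw with <-cmp (toℕ w) (toℕ t)
      ... | tri> _ _ t<w = ⊥-elim (crossing Ept Exw p<x x<t t<w)
      ... | tri≈ _ w≡t _ = inj₂ (toℕ-injective w≡t)
      ... | tri< w<t _ _ with <-cmp (toℕ w) (toℕ p)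
      ...   | tri< w<p _ _ = ⊥-elim (crossing (E-sym Exw) Ept w<p p<x x<t)
      ...   | tri> _ _ p<w = inj₁ (p<w , w<t)
      ...   | tri≈ _ w≡p _ = ⊥-elim (<⇒≱ x<t (t-min x (≤-refl , p<x , E-sym (subst (E e x) (toℕ-injective w≡p) Exw))))

  -- A walk from p to p + 1 steps over the gap between them, and the outermost chord s–t doing so is p–(p+1):
  -- otherwise s (if s < p) or t (if t > p + 1) would be a cut vertex.
  successor-adjacent : ∀ p q → toℕ q ≡ suc (toℕ p) → E e p q
  successor-adjacent p q q≡1+p
    with walk-steps-over (toℕ p) (proj₁ (proj₂ 2-conn) (vertexAt p) (vertexAt q))
           (≤-reflexive (cong toℕ (positionOf-vertexAt p)))
           (subst (λ r → toℕ p < toℕ r) (sym (positionOf-vertexAt q)) (≤-reflexive (sym q≡1+p)))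
  ... | s₀ , t₀ , span₀ with greatest (λ s → any? (SpansOver? p s)) s₀ (t₀ , span₀)
  ... | s , (t₁ , span₁) , s-max with least (SpansOver? p s) t₁ span₁
  ... | t , span , t-min with toℕ-injective (outermost-span-starts-at span λ s′ t′ span′ → s-max s′ (t′ , span′))
  ... | refl with shortest-span-from-p-ends-at-successor q≡1+p span t-min
  ... | refl = proj₂ (proj₂ span)

  -- If p and q were not adjacent, the neighbour t of p furthest round the circle would separate q from p.
  ends-adjacent : ∀ p q → toℕ p ≡ 0 → suc (toℕ q) ≡ n → E e p q
  ends-adjacent p q p≡0 1+q≡n = decidable-stable (E? p q) no-gap
    where
    3≤n : 3 ≤ n
    3≤n = proj₁ 2-conn
    one : Fin n
    one = fromℕ< (≤-trans (s≤s (s≤s z≤n)) 3≤n)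
    p∼one : E e p one
    p∼one = successor-adjacent p one (trans (toℕ-fromℕ< _) (cong suc (sym p≡0)))

    no-gap : ¬ ¬ E e p q
    no-gap ¬Epq with greatest (E? p) one p∼one
    ... | t , Ept , t-max = n≮0 (subst (toℕ t <_) p≡0 (closure-avoiding C t closed q≢t p≢t t<q))
      where
      C : Fin n → Set
      C x = toℕ t < toℕ x
      t<q : toℕ t < toℕ q
      t<q = ≤∧≢⇒< (≤-pred (subst (toℕ t <_) (sym 1+q≡n) (toℕ<n t)))
                  (λ t≡q → ¬Epq (subst (E e p) (toℕ-injective t≡q) Ept))
      p≢t : p ≢ t
      p≢t refl = E-irrefl Ept
      q≢t : q ≢ t
      q≢t refl = <-irrefl refl t<q
      closed : ∀ x w → C x → E e x w → C w ⊎ w ≡ t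
      closed x w t<x Exw with <-cmp (toℕ w) (toℕ t)
      ... | tri> _ _ t<w = inj₁ t<w
      ... | tri≈ _ w≡t _ = inj₂ (toℕ-injective w≡t)
      ... | tri< w<t _ _ with toℕ w ℕ.≟ 0
      ...   | yes w≡0 = ⊥-elim (<⇒≱ t<x (t-max x (E-sym (subst (λ r → E e x r) (toℕ-injective (trans w≡0 (sym p≡0))) Exw))))
      ...   | no w≢0  = ⊥-elim (crossing Ept (E-sym Exw) (subst (_< toℕ w) (sym p≡0) (n≢0⇒n>0 w≢0)) w<t t<x)

-- Faces lying under a chord

module Faces {n} {G : Graph n} (e : OuterplanarEmbedding G) where
  open Drawing e

  LongEdge : Fin n → Fin n → Set
  LongEdge u v = E e u v × suc (suc (toℕ u)) ≤ toℕ v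

  LongEdge? : ∀ u v → Dec (LongEdge u v)
  LongEdge? u v = E? u v ×-dec (suc (suc (toℕ u)) ≤? toℕ v)

  LongEdge⇒< : ∀ {u v} → LongEdge u v → toℕ u < toℕ v
  LongEdge⇒< (_ , 2+u≤v) = ≤-trans (n≤1+n _) 2+u≤v

  Covered : Fin n → Fin n → Fin n → Set
  Covered u v x = ∃₂ λ s t → toℕ u ≤ toℕ s × toℕ s < toℕ x × toℕ x < toℕ t × toℕ t ≤ toℕ v
                           × E e s t × ¬ (s ≡ u × t ≡ v)

  Covered? : ∀ u v x → Dec (Covered u v x)
  Covered? u v x = any? λ s → any? λ t → (toℕ u ≤? toℕ s) ×-dec (toℕ s <? toℕ x) ×-dec (toℕ x <? toℕ t)
                     ×-dec (toℕ t ≤? toℕ v) ×-dec E? s t ×-dec ¬? ((s ≟ᶠ u) ×-dec (t ≟ᶠ v))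

  Visible : Fin n → Fin n → Fin n → Set
  Visible u v x = toℕ u ≤ toℕ x × toℕ x ≤ toℕ v × ¬ Covered u v x

  Visible? : ∀ u v x → Dec (Visible u v x)
  Visible? u v x = (toℕ u ≤? toℕ x) ×-dec (toℕ x ≤? toℕ v) ×-dec ¬? (Covered? u v x)

  -- The face directly under the chord u–v.  Abstract, so that u and v can be inferred from faceUnder u v.
  abstract
    faceUnder : Fin n → Fin n → Subset n
    faceUnder u v = subsetOf (Visible? u v)

    ∈faceUnder⁺ : ∀ {u v x} → Visible u v x → x ∈ faceUnder u v
    ∈faceUnder⁺ {u} {v} = ∈subsetOf⁺ (Visible? u v)

    ∈faceUnder⁻ : ∀ {u v x} → x ∈ faceUnder u v → Visible u v x
    ∈faceUnder⁻ {u} {v} = ∈subsetOf⁻ (Visible? u v)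

  module _ {u v : Fin n} where

    visible⇒∈faceUnder : ∀ {x} → toℕ u ≤ toℕ x → toℕ x ≤ toℕ v → ¬ Covered u v x → x ∈ faceUnder u v
    visible⇒∈faceUnder u≤x x≤v uncovered = ∈faceUnder⁺ (u≤x , x≤v , uncovered)

    ∈faceUnder⇒≥ : ∀ {x} → x ∈ faceUnder u v → toℕ u ≤ toℕ x
    ∈faceUnder⇒≥ x∈ = proj₁ (∈faceUnder⁻ x∈)

    ∈faceUnder⇒≤ : ∀ {x} → x ∈ faceUnder u v → toℕ x ≤ toℕ v
    ∈faceUnder⇒≤ x∈ = proj₁ (proj₂ (∈faceUnder⁻ x∈))

    ∈faceUnder⇒uncovered : ∀ {x} → x ∈ faceUnder u v → ¬ Covered u v x
    ∈faceUnder⇒uncovered x∈ = proj₂ (proj₂ (∈faceUnder⁻ x∈))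

    ∉faceUnder⇒covered : ∀ {x} → toℕ u ≤ toℕ x → toℕ x ≤ toℕ v → x ∉ faceUnder u v → Covered u v x
    ∉faceUnder⇒covered u≤x x≤v x∉ = decidable-stable (Covered? u v _) (x∉ ∘ visible⇒∈faceUnder u≤x x≤v)

    u∈faceUnder : toℕ u ≤ toℕ v → u ∈ faceUnder u v
    u∈faceUnder u≤v = visible⇒∈faceUnder ≤-refl u≤v λ (_ , _ , u≤s , s<u , _) → <-irrefl refl (≤-<-trans u≤s s<u)

    v∈faceUnder : toℕ u ≤ toℕ v → v ∈ faceUnder u v
    v∈faceUnder u≤v = visible⇒∈faceUnder u≤v ≤-refl λ (_ , _ , _ , _ , v<t , t≤v , _) → <-irrefl refl (<-≤-trans v<t t≤v)

  module _ (successor-adjacent : ∀ p q → toℕ q ≡ suc (toℕ p) → E e p q)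
           {u v : Fin n} (uv : LongEdge u v) where
    private
      u<v = LongEdge⇒< uv
      u∈ = u∈faceUnder (<⇒≤ u<v)
      v∈ = v∈faceUnder (<⇒≤ u<v)

      Gap : Fin n → Fin n → Set
      Gap x y = ∀ r → r ∈ faceUnder u v → toℕ x < toℕ r → toℕ r < toℕ y → ⊥

      ChordFrom : Fin n → Fin n → Set
      ChordFrom x t = suc (toℕ x) < toℕ t × toℕ t ≤ toℕ v × E e x t × ¬ (x ≡ u × t ≡ v)

      ChordFrom? : ∀ x t → Dec (ChordFrom x t)
      ChordFrom? x t = (suc (toℕ x) <? toℕ t) ×-dec (toℕ t ≤? toℕ v) ×-dec E? x t ×-dec ¬? ((x ≟ᶠ u) ×-dec (t ≟ᶠ v))

      -- the furthest neighbour of u below v is a third corner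
      corner : ∃ λ c → toℕ u < toℕ c × toℕ c < toℕ v × c ∈ faceUnder u v
      corner with next {x = u} {v} u<v
      ... | u′ , u′≡1+u with greatest (λ t → (toℕ u <? toℕ t) ×-dec (toℕ t <? toℕ v) ×-dec E? u t) u′
                               (≤-reflexive (sym u′≡1+u) , subst (_< toℕ v) (sym u′≡1+u) (proj₂ uv) ,
                                successor-adjacent u u′ u′≡1+u)
      ... | c , (u<c , c<v , Euc) , c-max = c , u<c , c<v , visible⇒∈faceUnder (<⇒≤ u<c) (<⇒≤ c<v) uncovered
        where
        uncovered : ¬ Covered u v c
        uncovered (s , t , u≤s , s<c , c<t , t≤v , Est , st≢uv) with m≤n⇒m<n∨m≡n u≤s | m≤n⇒m<n∨m≡n t≤v
        ... | inj₁ u<s | _        = crossing Euc Est u<s s<c c<t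
        ... | inj₂ u≡s | inj₂ t≡v = st≢uv (toℕ-injective (sym u≡s) , toℕ-injective t≡v)
        ... | inj₂ u≡s | inj₁ t<v = <⇒≱ c<t (c-max t (<-trans u<c c<t , t<v ,
                                       subst (λ r → E e r t) (toℕ-injective (sym u≡s)) Est))

      faceUnder-3≤∣∣ : 3 ≤ ∣ faceUnder u v ∣
      faceUnder-3≤∣∣ with corner
      ... | c , u<c , c<v , c∈ =
        x≢y≢z⇒3≤∣p∣ (<⇒≢ u<c ∘ cong toℕ) (<⇒≢ u<v ∘ cong toℕ) (<⇒≢ c<v ∘ cong toℕ) u∈ c∈ v∈

      chord-over-successor : ∀ {x y} → x ∈ faceUnder u v → y ∈ faceUnder u v → suc (toℕ x) < toℕ y →
                             Gap x y → ∃ (ChordFrom x)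
      chord-over-successor {x} {y} x∈ y∈ 1+x<y gap with next {x = x} {y} (<-trans (n<1+n _) 1+x<y)
      ... | x′ , x′≡1+x with ∉faceUnder⇒covered (subst (toℕ u ≤_) (sym x′≡1+x) (≤-trans (∈faceUnder⇒≥ x∈) (n≤1+n _)))
                                                (subst (_≤ toℕ v) (sym x′≡1+x) (≤-trans (<⇒≤ 1+x<y) (∈faceUnder⇒≤ y∈)))
                                                (λ x′∈ → gap x′ x′∈ (≤-reflexive (sym x′≡1+x)) (subst (_< toℕ y) (sym x′≡1+x) 1+x<y))
      ... | s , t , u≤s , s<x′ , x′<t , t≤v , Est , st≢uv with <-cmp (toℕ s) (toℕ x)
      ...   | tri< s<x _ _ = ⊥-elim (∈faceUnder⇒uncovered x∈ (s , t , u≤s , s<x ,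
                                       <-trans (≤-reflexive (sym x′≡1+x)) x′<t , t≤v , Est , st≢uv))
      ...   | tri> _ _ x<s = ⊥-elim (<⇒≱ x<s (≤-pred (subst (toℕ s <_) x′≡1+x s<x′)))
      ...   | tri≈ _ s≡x _ = t , subst (_< toℕ t) x′≡1+x x′<t , t≤v ,
                             subst (λ r → E e r t ×  ¬ (r ≡ u × t ≡ v)) (toℕ-injective s≡x) (Est , st≢uv)

      gap⇒E : ∀ {x y} → x ∈ faceUnder u v → y ∈ faceUnder u v → toℕ x < toℕ y → Gap x y → E e x y
      gap⇒E {x} {y} x∈ y∈ x<y gap with m≤n⇒m<n∨m≡n x<y
      ... | inj₂ 1+x≡y = successor-adjacent x y (sym 1+x≡y)
      ... | inj₁ 1+x<y with chord-over-successor x∈ y∈ 1+x<y gap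
      ... | t₀ , chord₀ with greatest (ChordFrom? x) t₀ chord₀
      ... | t , (1+x<t , t≤v , Ext , xt≢uv) , t-max with <-cmp (toℕ t) (toℕ y)
      ...   | tri≈ _ t≡y _ = subst (E e x) (toℕ-injective t≡y) Ext
      ...   | tri> _ _ y<t = ⊥-elim (∈faceUnder⇒uncovered y∈ (x , t , ∈faceUnder⇒≥ x∈ , x<y , y<t , t≤v , Ext , xt≢uv))
      ...   | tri< t<y _ _ = ⊥-elim (t-uncovered (∉faceUnder⇒covered (≤-trans (∈faceUnder⇒≥ x∈) (<⇒≤ x<t))
                                     (≤-trans (<⇒≤ t<y) (∈faceUnder⇒≤ y∈)) (λ t∈ → gap t t∈ x<t t<y)))
        -- t lies strictly between two consecutive corners, so some chord covers it; every candidate contradicts x–t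
        where
        x<t : toℕ x < toℕ t
        x<t = <-trans (n<1+n _) 1+x<t
        t-uncovered : ¬ Covered u v t
        t-uncovered (s′ , t′ , u≤s′ , s′<t , t<t′ , t′≤v , Es′t′ , ne) with <-cmp (toℕ s′) (toℕ x)
        ... | tri< s′<x _ _ = ∈faceUnder⇒uncovered x∈ (s′ , t′ , u≤s′ , s′<x , <-trans x<t t<t′ , t′≤v , Es′t′ , ne)
        ... | tri> _ _ x<s′ = crossing Ext Es′t′ x<s′ s′<t t<t′
        ... | tri≈ _ s′≡x _ = <⇒≱ t<t′ (t-max t′ (<-trans 1+x<t t<t′ , t′≤v ,
                                 subst (λ r → E e r t′ × ¬ (r ≡ u × t′ ≡ v)) (toℕ-injective s′≡x) (Es′t′ , ne)))

      top-corner : ∀ {x} → x ∈ faceUnder u v → (∀ r → r ∈ faceUnder u v → toℕ x < toℕ r → ⊥) → x ≡ v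
      top-corner x∈ nothing-above with m≤n⇒m<n∨m≡n (∈faceUnder⇒≤ x∈)
      ... | inj₁ x<v = ⊥-elim (nothing-above v v∈ x<v)
      ... | inj₂ x≡v = toℕ-injective x≡v

      bottom-corner : ∀ {x} → x ∈ faceUnder u v → (∀ r → r ∈ faceUnder u v → toℕ r < toℕ x → ⊥) → x ≡ u
      bottom-corner x∈ nothing-below with m≤n⇒m<n∨m≡n (∈faceUnder⇒≥ x∈)
      ... | inj₁ u<x = ⊥-elim (nothing-below u u∈ u<x)
      ... | inj₂ u≡x = toℕ-injective (sym u≡x)

      Consecutive⇒E : ∀ x y → Consecutive (faceUnder u v) x y → E e x y
      Consecutive⇒E x y (x∈ , y∈ , inj₁ (inj₁ (x<y , gap))) = gap⇒E x∈ y∈ x<y gap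
      Consecutive⇒E x y (x∈ , y∈ , inj₂ (inj₁ (y<x , gap))) = E-sym (gap⇒E y∈ x∈ y<x gap)
      Consecutive⇒E x y (x∈ , y∈ , inj₁ (inj₂ (_ , nothing-above , nothing-below))) =
        subst₂ (E e) (sym (top-corner x∈ nothing-above)) (sym (bottom-corner y∈ nothing-below)) (E-sym (proj₁ uv))
      Consecutive⇒E x y (x∈ , y∈ , inj₂ (inj₂ (_ , nothing-above , nothing-below))) =
        subst₂ (E e) (sym (bottom-corner x∈ nothing-below)) (sym (top-corner y∈ nothing-above)) (proj₁ uv)

      E⇒Consecutive< : ∀ {x y} → x ∈ faceUnder u v → y ∈ faceUnder u v → toℕ x < toℕ y → E e x y →
                        Consecutive (faceUnder u v) x y
      E⇒Consecutive< {x} {y} x∈ y∈ x<y Exy with (x ≟ᶠ u) ×-dec (y ≟ᶠ v)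
      ... | yes (refl , refl) = x∈ , y∈ , inj₂ (inj₂ (x<y , (λ r r∈ y<r → <⇒≱ y<r (∈faceUnder⇒≤ r∈))
                                                          , (λ r r∈ r<x → <⇒≱ r<x (∈faceUnder⇒≥ r∈))))
      ... | no xy≢uv = x∈ , y∈ , inj₁ (inj₁ (x<y , λ r r∈ x<r r<y →
                         ∈faceUnder⇒uncovered r∈ (x , y , ∈faceUnder⇒≥ x∈ , x<r , r<y , ∈faceUnder⇒≤ y∈ , Exy , xy≢uv)))

      E⇒Consecutive : ∀ x y → x ∈ faceUnder u v → y ∈ faceUnder u v → x ≢ y → E e x y →
                      Consecutive (faceUnder u v) x y
      E⇒Consecutive x y x∈ y∈ x≢y Exy with <-cmp (toℕ x) (toℕ y)
      ... | tri< x<y _ _ = E⇒Consecutive< x∈ y∈ x<y Exy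
      ... | tri≈ _ x≡y _ = ⊥-elim (x≢y (toℕ-injective x≡y))
      ... | tri> _ _ y<x = Consecutive-sym (E⇒Consecutive< y∈ x∈ y<x (E-sym Exy))

    faceUnder-isFace : IsFace e (faceUnder u v)
    faceUnder-isFace = faceUnder-3≤∣∣ , Consecutive⇒E , E⇒Consecutive

  module _ {F : Subset n} (F-face : IsFace e F) where
    private
      some : Nonempty F
      some = 1≤∣p∣⇒Nonempty (≤-trans (s≤s z≤n) (proj₁ F-face))
      lowest : ∃ λ m → m ∈ F × (∀ x → x ∈ F → toℕ m ≤ toℕ x)
      lowest = least (_∈? F) (proj₁ some) (proj₂ some)
      highest : ∃ λ M → M ∈ F × (∀ x → x ∈ F → toℕ x ≤ toℕ M)
      highest = greatest (_∈? F) (proj₁ some) (proj₂ some)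

      m M : Fin n
      m = proj₁ lowest
      M = proj₁ highest
      m∈ : m ∈ F
      m∈ = proj₁ (proj₂ lowest)
      M∈ : M ∈ F
      M∈ = proj₁ (proj₂ highest)
      m-min : ∀ x → x ∈ F → toℕ m ≤ toℕ x
      m-min = proj₂ (proj₂ lowest)
      M-max : ∀ x → x ∈ F → toℕ x ≤ toℕ M
      M-max = proj₂ (proj₂ highest)

      middle : ∃ λ z → z ∈ F × toℕ m < toℕ z × toℕ z < toℕ M
      middle with 3≤∣p∣⇒∃-third (proj₁ F-face) m M
      ... | z , z∈ , z≢m , z≢M = z , z∈ , ≤∧≢⇒< (m-min z z∈) (z≢m ∘ toℕ-injective ∘ sym)
                                         , ≤∧≢⇒< (M-max z z∈) (z≢M ∘ toℕ-injective)

      m<M : toℕ m < toℕ M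
      m<M = <-trans (proj₁ (proj₂ (proj₂ middle))) (proj₂ (proj₂ (proj₂ middle)))

      mM-long : LongEdge m M
      mM-long = E-sym (proj₁ (proj₂ F-face) M m (M∈ , m∈ , inj₁ (inj₂ (m<M ,
                  (λ r r∈ M<r → <⇒≱ M<r (M-max r r∈)) , (λ r r∈ r<m → <⇒≱ r<m (m-min r r∈))))))
              , ≤-trans (s≤s (proj₁ (proj₂ (proj₂ middle)))) (proj₂ (proj₂ (proj₂ middle)))

      bracket : ∀ s → s ∉ F → ∀ a b → a ∈ F → b ∈ F → toℕ a < toℕ s → toℕ s < toℕ b →
                ∃₂ λ c c′ → c ∈ F × toℕ a ≤ toℕ c × toℕ c < toℕ s × toℕ s < toℕ c′ × toℕ c′ ≤ toℕ b
                          × E e c c′ × (∀ r → r ∈ F → toℕ c < toℕ r → toℕ r < toℕ c′ → ⊥)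
      bracket s s∉ a b a∈ b∈ a<s s<b
        with greatest (λ r → (r ∈? F) ×-dec (toℕ r <? toℕ s)) a (a∈ , a<s)
           | least    (λ r → (r ∈? F) ×-dec (toℕ s <? toℕ r)) b (b∈ , s<b)
      ... | c , (c∈ , c<s) , c-max | c′ , (c′∈ , s<c′) , c′-min =
        c , c′ , c∈ , c-max a (a∈ , a<s) , c<s , s<c′ , c′-min b (b∈ , s<b) ,
        proj₁ (proj₂ F-face) c c′ (c∈ , c′∈ , inj₁ (inj₁ (<-trans c<s s<c′ , gap))) , gap
        where
        gap : ∀ r → r ∈ F → toℕ c < toℕ r → toℕ r < toℕ c′ → ⊥
        gap r r∈ c<r r<c′ with <-cmp (toℕ r) (toℕ s)
        ... | tri< r<s _ _ = <⇒≱ c<r (c-max r (r∈ , r<s))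
        ... | tri≈ _ r≡s _ = s∉ (subst (_∈ F) (toℕ-injective r≡s) r∈)
        ... | tri> _ _ s<r = <⇒≱ r<c′ (c′-min r (r∈ , s<r))

      F⊆faceUnder : F ⊆ faceUnder m M
      F⊆faceUnder {x} x∈ = visible⇒∈faceUnder (m-min x x∈) (M-max x x∈) uncovered
        where
        uncovered : ¬ Covered m M x
        uncovered (s , t , m≤s , s<x , x<t , t≤M , Est , st≢mM) with s ∈? F | t ∈? F
        ... | no s∉ | _ with bracket s s∉ m x m∈ x∈ (≤∧≢⇒< m≤s (s∉ ∘ λ m≡s → subst (_∈ F) (toℕ-injective m≡s) m∈)) s<x
        ...   | _ , _ , _ , _ , c<s , s<c′ , c′≤x , Ecc′ , _ = crossing Ecc′ Est c<s s<c′ (≤-<-trans c′≤x x<t)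
        uncovered (s , t , m≤s , s<x , x<t , t≤M , Est , st≢mM) | yes _ | no t∉
          with bracket t t∉ x M x∈ M∈ x<t (≤∧≢⇒< t≤M (t∉ ∘ λ t≡M → subst (_∈ F) (toℕ-injective (sym t≡M)) M∈))
        ... | _ , _ , _ , x≤c , c<t , t<c′ , _ , Ecc′ , _ = crossing Est Ecc′ (<-≤-trans s<x x≤c) c<t t<c′
        uncovered (s , t , m≤s , s<x , x<t , t≤M , Est , st≢mM) | yes s∈ | yes t∈
          with proj₂ (proj₂ F-face) s t s∈ t∈ (<⇒≢ (<-trans s<x x<t) ∘ cong toℕ) Est
        ... | _ , _ , inj₁ (inj₁ (_ , gap)) = gap x x∈ s<x x<t
        ... | _ , _ , inj₁ (inj₂ (t<s , _)) = <-asym t<s (<-trans s<x x<t)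
        ... | _ , _ , inj₂ (inj₁ (t<s , _)) = <-asym t<s (<-trans s<x x<t)
        ... | _ , _ , inj₂ (inj₂ (_ , nothing-above , nothing-below)) = st≢mM (s≡m , t≡M)
          where
          s≡m : s ≡ m
          s≡m with m≤n⇒m<n∨m≡n m≤s
          ... | inj₁ m<s = ⊥-elim (nothing-below m m∈ m<s)
          ... | inj₂ m≡s = toℕ-injective (sym m≡s)
          t≡M : t ≡ M
          t≡M with m≤n⇒m<n∨m≡n t≤M
          ... | inj₁ t<M = ⊥-elim (nothing-above M M∈ t<M)
          ... | inj₂ t≡M = toℕ-injective t≡M

      faceUnder⊆F : faceUnder m M ⊆ F
      faceUnder⊆F {x} x∈ with x ∈? F
      ... | yes x∈F = x∈F
      ... | no  x∉F with bracket x x∉F m M m∈ M∈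
                           (≤∧≢⇒< (∈faceUnder⇒≥ x∈) (x∉F ∘ λ m≡x → subst (_∈ F) (toℕ-injective m≡x) m∈))
                           (≤∧≢⇒< (∈faceUnder⇒≤ x∈) (x∉F ∘ λ x≡M → subst (_∈ F) (toℕ-injective (sym x≡M)) M∈))
      ... | c , c′ , c∈ , m≤c , c<x , x<c′ , c′≤M , Ecc′ , gap with (c ≟ᶠ m) ×-dec (c′ ≟ᶠ M)
      ...   | no cc′≢mM = ⊥-elim (∈faceUnder⇒uncovered x∈ (c , c′ , m≤c , c<x , x<c′ , c′≤M , Ecc′ , cc′≢mM))
      ...   | yes (refl , refl) with middle
      ...     | z , z∈ , m<z , z<M = ⊥-elim (gap z z∈ m<z z<M)

    face≡faceUnder : ∃₂ λ m M → LongEdge m M × F ≡ faceUnder m M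
    face≡faceUnder = m , M , mM-long , ⊆-antisym F⊆faceUnder faceUnder⊆F

  chord-spanning-corners : ∀ {m M s t x y} → x ∈ faceUnder m M → y ∈ faceUnder m M → toℕ x < toℕ y →
                           E e s t → toℕ m ≤ toℕ s → toℕ s ≤ toℕ x → toℕ y ≤ toℕ t → toℕ t ≤ toℕ M →
                           ¬ (s ≡ m × t ≡ M) → s ≡ x × t ≡ y
  chord-spanning-corners x∈ y∈ x<y Est m≤s s≤x y≤t t≤M st≢mM with m≤n⇒m<n∨m≡n s≤x
  ... | inj₁ s<x = ⊥-elim (∈faceUnder⇒uncovered x∈ (_ , _ , m≤s , s<x , <-≤-trans x<y y≤t , t≤M , Est , st≢mM))
  ... | inj₂ s≡x with m≤n⇒m<n∨m≡n y≤t
  ...   | inj₁ y<t = ⊥-elim (∈faceUnder⇒uncovered y∈ (_ , _ , m≤s , ≤-<-trans (≤-reflexive s≡x) x<y , y<t , t≤M , Est , st≢mM))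
  ...   | inj₂ y≡t = toℕ-injective s≡x , toℕ-injective (sym y≡t)

  -- The configuration at which the two-ended sweep below stalls.
  SeparatedLongEdges : Set
  SeparatedLongEdges = ∃₂ λ l a → ∃₂ λ b r → LongEdge l a × LongEdge b r × toℕ a ≤ toℕ b

  innermost⇒interval⊆faceUnder : ∀ {p q} → Innermost LongEdge p q →
                                 ∀ x → toℕ p ≤ toℕ x → toℕ x ≤ toℕ q → x ∈ faceUnder p q
  innermost⇒interval⊆faceUnder pq-innermost x p≤x x≤q =
    visible⇒∈faceUnder p≤x x≤q λ (s , t , p≤s , s<x , x<t , t≤q , Est , st≢pq) →
      st≢pq (proj₂ pq-innermost s t (Est , ≤-trans (s≤s s<x) x<t) p≤s t≤q)

-- Leaves of the weak dual

NotTop : ∀ {n} → Fin n → Fin n → Set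
NotTop {n} u v = 0 < toℕ u ⊎ suc (toℕ v) < n

module Leaves {n} {G : Graph n} (e : OuterplanarEmbedding G) (2-conn : TwoConnected G) where
  open Drawing e
  open Faces e
  open OuterCycle e 2-conn

  Encloses : Fin n → Fin n → Fin n → Fin n → Set
  Encloses p q s t = E e s t × toℕ s ≤ toℕ p × toℕ q ≤ toℕ t × ¬ (s ≡ p × t ≡ q)

  nearest-enclosing : ∀ {p q} → toℕ p < toℕ q → NotTop p q → ∃₂ λ S T → Innermost (Encloses p q) S T
  nearest-enclosing {p} {q} p<q pq-not-top = forget-bounds (innermost Encloses? Encloses⇒≤ first last top-encloses)
    where
    forget-bounds : ∀ {u v : Fin n} → (∃₂ λ S T → toℕ u ≤ toℕ S × toℕ T ≤ toℕ v × Innermost (Encloses p q) S T) →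
                    ∃₂ λ S T → Innermost (Encloses p q) S T
    forget-bounds (S , T , _ , _ , ST-nearest) = S , T , ST-nearest

    Encloses? : ∀ s t → Dec (Encloses p q s t)
    Encloses? s t = E? s t ×-dec (toℕ s ≤? toℕ p) ×-dec (toℕ q ≤? toℕ t) ×-dec ¬? ((s ≟ᶠ p) ×-dec (t ≟ᶠ q))

    Encloses⇒≤ : ∀ {s t} → Encloses p q s t → toℕ s ≤ toℕ t
    Encloses⇒≤ (_ , s≤p , q≤t , _) = ≤-trans s≤p (≤-trans (<⇒≤ p<q) q≤t)

    0<n : 0 < n
    0<n = ≤-<-trans z≤n (toℕ<n p)

    first last : Fin n
    first = fromℕ< 0<n
    last  = fromℕ< (∸-monoʳ-< {n} {1} {0} (s≤s z≤n) 0<n)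

    1+last≡n : suc (toℕ last) ≡ n
    1+last≡n = trans (cong suc (toℕ-fromℕ< _)) (trans (+-comm 1 (n ∸ 1)) (m∸n+n≡m 0<n))

    top-encloses : Encloses p q first last
    top-encloses = ends-adjacent first last (toℕ-fromℕ< _) 1+last≡n
                 , subst (_≤ toℕ p) (sym (toℕ-fromℕ< 0<n)) z≤n
                 , ≤-pred (subst (toℕ q <_) (sym 1+last≡n) (toℕ<n q))
                 , λ (first≡p , last≡q) → [ <-irrefl (trans (sym (toℕ-fromℕ< 0<n)) (cong toℕ first≡p))
                                          , <-irrefl (trans (cong suc (sym (cong toℕ last≡q))) 1+last≡n) ]′ pq-not-top

  -- The face under an innermost chord p–q is the whole interval [p, q]; all its sides but p–q are outer
  -- edges, so its only neighbour is the face on the other side of p–q, under the nearest enclosing chord.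
  module _ {p q S T : Fin n} (pq-innermost : Innermost LongEdge p q) (ST-nearest : Innermost (Encloses p q) S T) where
    private
      pq-long : LongEdge p q
      pq-long = proj₁ pq-innermost
      Epq : E e p q
      Epq = proj₁ pq-long
      p<q : toℕ p < toℕ q
      p<q = LongEdge⇒< pq-long
      pq-face : IsFace e (faceUnder p q)
      pq-face = faceUnder-isFace successor-adjacent pq-long

      interval⊆faceUnder : ∀ x → toℕ p ≤ toℕ x → toℕ x ≤ toℕ q → x ∈ faceUnder p q
      interval⊆faceUnder = innermost⇒interval⊆faceUnder pq-innermost

      p∈ : p ∈ faceUnder p q
      p∈ = interval⊆faceUnder p ≤-refl (<⇒≤ p<q)
      q∈ : q ∈ faceUnder p q
      q∈ = interval⊆faceUnder q (<⇒≤ p<q) ≤-refl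

      consecutive-in-interval : ∀ {x y} → Consecutive (faceUnder p q) x y → toℕ x < toℕ y →
                                toℕ y ≡ suc (toℕ x) ⊎ (x ≡ p × y ≡ q)
      consecutive-in-interval {x} {y} (x∈ , y∈ , inj₁ (inj₁ (_ , gap))) x<y with m≤n⇒m<n∨m≡n x<y
      ... | inj₂ 1+x≡y = inj₁ (sym 1+x≡y)
      ... | inj₁ 1+x<y with next {x = x} {y} x<y
      ...   | x′ , x′≡1+x = ⊥-elim (gap x′ (interval⊆faceUnder x′
                              (subst (toℕ p ≤_) (sym x′≡1+x) (≤-trans (∈faceUnder⇒≥ x∈) (n≤1+n _)))
                              (subst (_≤ toℕ q) (sym x′≡1+x) (≤-trans (<⇒≤ 1+x<y) (∈faceUnder⇒≤ y∈))))
                              (≤-reflexive (sym x′≡1+x)) (subst (_< toℕ y) (sym x′≡1+x) 1+x<y))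
      consecutive-in-interval (_ , _ , inj₁ (inj₂ (y<x , _))) x<y = ⊥-elim (<-asym x<y y<x)
      consecutive-in-interval (_ , _ , inj₂ (inj₁ (y<x , _))) x<y = ⊥-elim (<-asym x<y y<x)
      consecutive-in-interval (x∈ , y∈ , inj₂ (inj₂ (_ , nothing-above , nothing-below))) _ = inj₂ (x≡p , y≡q)
        where
        x≡p = toℕ-injective (≤-antisym (≮⇒≥ λ p<x → nothing-below p p∈ p<x) (∈faceUnder⇒≥ x∈))
        y≡q = toℕ-injective (≤-antisym (∈faceUnder⇒≤ y∈) (≮⇒≥ λ y<q → nothing-above q q∈ y<q))

      EST : E e S T
      EST = proj₁ (proj₁ ST-nearest)
      S≤p : toℕ S ≤ toℕ p
      S≤p = proj₁ (proj₂ (proj₁ ST-nearest))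
      q≤T : toℕ q ≤ toℕ T
      q≤T = proj₁ (proj₂ (proj₂ (proj₁ ST-nearest)))
      ST≢pq : ¬ (S ≡ p × T ≡ q)
      ST≢pq = proj₂ (proj₂ (proj₂ (proj₁ ST-nearest)))

      ST-long : LongEdge S T
      ST-long = EST , ≤-trans (s≤s (s≤s S≤p)) (≤-trans (proj₂ pq-long) q≤T)

      ST-face : IsFace e (faceUnder S T)
      ST-face = faceUnder-isFace successor-adjacent ST-long

      p∈ST : p ∈ faceUnder S T
      p∈ST = visible⇒∈faceUnder S≤p (≤-trans (<⇒≤ p<q) q≤T) uncovered
        where
        uncovered : ¬ Covered S T p
        uncovered (a , b , S≤a , a<p , p<b , b≤T , Eab , ab≢ST) with <-cmp (toℕ b) (toℕ q)
        ... | tri< b<q _ _ = crossing Eab Epq a<p p<b b<q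
        ... | tri≈ _ b≡q _ = ab≢ST (proj₂ ST-nearest a b (Eab , <⇒≤ a<p , ≤-reflexive (sym b≡q) ,
                                     λ (a≡p , _) → <-irrefl (cong toℕ a≡p) a<p) S≤a b≤T)
        ... | tri> _ _ q<b = ab≢ST (proj₂ ST-nearest a b (Eab , <⇒≤ a<p , <⇒≤ q<b ,
                                     λ (a≡p , _) → <-irrefl (cong toℕ a≡p) a<p) S≤a b≤T)

      q∈ST : q ∈ faceUnder S T
      q∈ST = visible⇒∈faceUnder (≤-trans S≤p (<⇒≤ p<q)) q≤T uncovered
        where
        uncovered : ¬ Covered S T q
        uncovered (a , b , S≤a , a<q , q<b , b≤T , Eab , ab≢ST) with <-cmp (toℕ p) (toℕ a)
        ... | tri< p<a _ _ = crossing Epq Eab p<a a<q q<b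
        ... | tri≈ _ p≡a _ = ab≢ST (proj₂ ST-nearest a b (Eab , ≤-reflexive (sym p≡a) , <⇒≤ q<b ,
                                     λ (_ , b≡q) → <-irrefl (sym (cong toℕ b≡q)) q<b) S≤a b≤T)
        ... | tri> _ _ a<p = ab≢ST (proj₂ ST-nearest a b (Eab , <⇒≤ a<p , <⇒≤ q<b ,
                                     λ (_ , b≡q) → <-irrefl (sym (cong toℕ b≡q)) q<b) S≤a b≤T)

      faces-differ : faceUnder p q ≢ faceUnder S T
      faces-differ eq with next {x = p} {q} p<q
      ... | p′ , p′≡1+p = ∈faceUnder⇒uncovered (subst (p′ ∈_) eq p′∈)
          (p , q , S≤p , ≤-reflexive (sym p′≡1+p) , subst (_< toℕ q) (sym p′≡1+p) (proj₂ pq-long) , q≤T , Epq ,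
           λ (p≡S , q≡T) → ST≢pq (sym p≡S , sym q≡T))
        where
        p′∈ = interval⊆faceUnder p′ (subst (toℕ p ≤_) (sym p′≡1+p) (n≤1+n _))
                                    (subst (_≤ toℕ q) (sym p′≡1+p) (<⇒≤ (proj₂ pq-long)))

      adjacent : DualAdj e (faceUnder p q) (faceUnder S T)
      adjacent = pq-face , ST-face , faces-differ , p , q , p≢q , Epq ,
                 proj₂ (proj₂ pq-face) p q p∈ q∈ p≢q Epq , proj₂ (proj₂ ST-face) p q p∈ST q∈ST p≢q Epq
        where
        p≢q = <⇒≢ p<q ∘ cong toℕ

      shared-side : ∀ {H x y} → IsFace e H → faceUnder p q ≢ H → toℕ x < toℕ y →
                    Consecutive (faceUnder p q) x y → x ∈ H → y ∈ H → H ≡ faceUnder S T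
      shared-side {H} {x} {y} H-face pq≢H x<y x-y x∈H y∈H with face≡faceUnder H-face
      ... | m , M , mM-long , refl = side (consecutive-in-interval x-y x<y)
        where
        pq≢mM : ¬ (p ≡ m × q ≡ M)
        pq≢mM (refl , refl) = pq≢H refl
        x∈ = proj₁ x-y
        y∈ = proj₁ (proj₂ x-y)

        side : toℕ y ≡ suc (toℕ x) ⊎ (x ≡ p × y ≡ q) → faceUnder m M ≡ faceUnder S T
        side (inj₁ y≡1+x)
          with nested Epq (proj₁ mM-long) (∈faceUnder⇒≥ x∈) (∈faceUnder⇒≥ x∈H)
                      (<-≤-trans x<y (∈faceUnder⇒≤ y∈)) (<-≤-trans x<y (∈faceUnder⇒≤ y∈H))
        ... | inj₁ (p≤m , M≤q) = ⊥-elim (pq≢mM (map-× sym sym (proj₂ pq-innermost m M mM-long p≤m M≤q)))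
        ... | inj₂ (m≤p , q≤M) with chord-spanning-corners x∈H y∈H x<y Epq m≤p (∈faceUnder⇒≥ x∈) (∈faceUnder⇒≤ y∈) q≤M pq≢mM
        ...   | refl , refl = ⊥-elim (<-irrefl (sym y≡1+x) (proj₂ pq-long))
        side (inj₂ (refl , refl))
          with nested EST (proj₁ mM-long) S≤p (∈faceUnder⇒≥ x∈H) (<-≤-trans p<q q≤T) (<-≤-trans p<q (∈faceUnder⇒≤ y∈H))
        ... | inj₁ (S≤m , M≤T) with proj₂ ST-nearest m M (proj₁ mM-long , ∈faceUnder⇒≥ x∈H , ∈faceUnder⇒≤ y∈H ,
                                                            λ (m≡p , M≡q) → pq≢mM (sym m≡p , sym M≡q)) S≤m M≤T
        ...   | refl , refl = refl
        side (inj₂ (refl , refl)) | inj₂ (m≤S , T≤M) with (S ≟ᶠ m) ×-dec (T ≟ᶠ M)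
        ... | yes (refl , refl) = refl
        ... | no ST≢mM with chord-spanning-corners x∈H y∈H p<q EST m≤S S≤p q≤T T≤M ST≢mM
        ...   | S≡p , T≡q = ⊥-elim (ST≢pq (S≡p , T≡q))

    innermost-isLeaf : IsLeaf e (faceUnder p q)
    innermost-isLeaf = pq-face , faceUnder S T , adjacent , neighbour-unique
      where
      neighbour-unique : ∀ H → DualAdj e (faceUnder p q) H → H ≡ faceUnder S T
      neighbour-unique H (_ , H-face , pq≢H , x , y , x≢y , _ , x-y , x∈H , y∈H , _) with <-cmp (toℕ x) (toℕ y)
      ... | tri< x<y _ _ = shared-side H-face pq≢H x<y x-y x∈H y∈H
      ... | tri≈ _ x≡y _ = ⊥-elim (x≢y (toℕ-injective x≡y))
      ... | tri> _ _ y<x = shared-side H-face pq≢H y<x (Consecutive-sym x-y) y∈H x∈H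

  record LeafUnder (l a : Fin n) : Set where
    field
      leaf                : Subset n
      isLeaf              : IsLeaf e leaf
      within              : ∀ x → x ∈ leaf → toℕ l ≤ toℕ x × toℕ x ≤ toℕ a
      corner next-corner  : Fin n
      corner∈             : corner ∈ leaf
      next-corner∈        : next-corner ∈ leaf
      next-corner≡1+      : toℕ next-corner ≡ suc (toℕ corner)
      next-corner<a       : toℕ next-corner < toℕ a

  leaf-under : ∀ {l a} → LongEdge l a → NotTop l a → LeafUnder l a
  leaf-under {l} {a} la-long la-not-top =
    let p , q , l≤p , q≤a , pq-innermost = innermost LongEdge? (<⇒≤ ∘ LongEdge⇒<) l a la-long
        pq-long = proj₁ pq-innermost
        S , T , ST-nearest = nearest-enclosing (LongEdge⇒< pq-long)
          ([ (λ 0<l → inj₁ (<-≤-trans 0<l l≤p)) , (λ 1+a<n → inj₂ (≤-<-trans (s≤s q≤a) 1+a<n)) ]′ la-not-top)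
        p′ , p′≡1+p = next {x = p} {q} (LongEdge⇒< pq-long)
        interval⊆faceUnder = innermost⇒interval⊆faceUnder pq-innermost
    in record
      { leaf           = faceUnder p q
      ; isLeaf         = innermost-isLeaf pq-innermost ST-nearest
      ; within         = λ x x∈ → ≤-trans l≤p (∈faceUnder⇒≥ x∈) , ≤-trans (∈faceUnder⇒≤ x∈) q≤a
      ; corner         = p
      ; next-corner    = p′
      ; corner∈        = interval⊆faceUnder p ≤-refl (<⇒≤ (LongEdge⇒< pq-long))
      ; next-corner∈   = interval⊆faceUnder p′ (subst (toℕ p ≤_) (sym p′≡1+p) (n≤1+n _))
                                               (subst (_≤ toℕ q) (sym p′≡1+p) (<⇒≤ (proj₂ pq-long)))
      ; next-corner≡1+ = p′≡1+p
      ; next-corner<a  = subst (_< toℕ a) (sym p′≡1+p) (<-≤-trans (proj₂ pq-long) q≤a)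
      }

no-three-leaves : ∀ {n} {G : Graph n} {e : OuterplanarEmbedding G} → ExactlyTwoLeaves e →
                  ∀ {A B C} → IsLeaf e A → IsLeaf e B → IsLeaf e C → A ≢ B → A ≢ C → B ≢ C → ⊥
no-three-leaves (_ , _ , _ , _ , _ , one-of-two) A-leaf B-leaf C-leaf A≢B A≢C B≢C
  with one-of-two _ A-leaf | one-of-two _ B-leaf | one-of-two _ C-leaf
... | inj₁ refl | inj₁ refl | _         = A≢B refl
... | inj₂ refl | inj₂ refl | _         = A≢B refl
... | inj₁ refl | inj₂ refl | inj₁ refl = A≢C refl
... | inj₁ refl | inj₂ refl | inj₂ refl = B≢C refl
... | inj₂ refl | inj₁ refl | inj₁ refl = B≢C refl
... | inj₂ refl | inj₁ refl | inj₂ refl = A≢C refl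

-- Rotating a circular drawing

CyclicallyBetween : ℕ → ℕ → ℕ → Set
CyclicallyBetween a b c = (a < b × b < c) ⊎ (c < a × (a < b ⊎ b < c))

CycSucc⇒¬between : ∀ {n} {F : Subset n} {p q} → CycSucc F p q →
                    p ≢ q × (∀ r → r ∈ F → ¬ CyclicallyBetween (toℕ p) (toℕ r) (toℕ q))
CycSucc⇒¬between (inj₁ (p<q , gap)) = <⇒≢ p<q ∘ cong toℕ , λ
  { r r∈ (inj₁ (p<r , r<q)) → gap r r∈ p<r r<q
  ; r r∈ (inj₂ (q<p , _))   → <-asym p<q q<p }
CycSucc⇒¬between (inj₂ (q<p , nothing-above , nothing-below)) = <⇒≢ q<p ∘ cong toℕ ∘ sym , λ
  { r r∈ (inj₁ (p<r , r<q))       → <-asym q<p (<-trans p<r r<q)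
  ; r r∈ (inj₂ (_ , inj₁ p<r))    → nothing-above r r∈ p<r
  ; r r∈ (inj₂ (_ , inj₂ r<q))    → nothing-below r r∈ r<q }

¬between⇒CycSucc : ∀ {n} {F : Subset n} {p q} → p ≢ q →
                    (∀ r → r ∈ F → ¬ CyclicallyBetween (toℕ p) (toℕ r) (toℕ q)) → CycSucc F p q
¬between⇒CycSucc {p = p} {q} p≢q no-between with <-cmp (toℕ p) (toℕ q)
... | tri< p<q _ _ = inj₁ (p<q , λ r r∈ p<r r<q → no-between r r∈ (inj₁ (p<r , r<q)))
... | tri≈ _ p≡q _ = ⊥-elim (p≢q (toℕ-injective p≡q))
... | tri> _ _ q<p = inj₂ (q<p , (λ r r∈ p<r → no-between r r∈ (inj₂ (q<p , inj₁ p<r)))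
                              , (λ r r∈ r<q → no-between r r∈ (inj₂ (q<p , inj₂ r<q))))

data Successor (m : ℕ) : ℕ → ℕ → Set where
  wrap : Successor m m 0
  step : ∀ {a} → a < m → Successor m a (suc a)

between-successor : ∀ {m a b c a′ b′ c′} → Successor m a a′ → Successor m b b′ → Successor m c c′ →
                    CyclicallyBetween a b c → CyclicallyBetween a′ b′ c′
between-successor (step _)   (step _)   (step _)   (inj₁ (a<b , b<c))       = inj₁ (s≤s a<b , s≤s b<c)
between-successor (step _)   (step _)   (step _)   (inj₂ (c<a , inj₁ a<b)) = inj₂ (s≤s c<a , inj₁ (s≤s a<b))
between-successor (step _)   (step _)   (step _)   (inj₂ (c<a , inj₂ b<c)) = inj₂ (s≤s c<a , inj₂ (s≤s b<c))
between-successor wrap       (step b<m) (step _)   (inj₁ (m<b , _))        = ⊥-elim (<-asym m<b b<m)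
between-successor wrap       (step b<m) (step _)   (inj₂ (_ , inj₁ m<b))   = ⊥-elim (<-asym m<b b<m)
between-successor wrap       (step _)   (step _)   (inj₂ (_ , inj₂ b<c))   = inj₁ (s≤s z≤n , s≤s b<c)
between-successor (step _)   wrap       (step c<m) (inj₁ (_ , m<c))        = ⊥-elim (<-asym m<c c<m)
between-successor (step _)   wrap       (step _)   (inj₂ (c<a , _))        = inj₂ (s≤s c<a , inj₂ (s≤s z≤n))
between-successor (step _)   (step _)   wrap       (inj₁ (a<b , _))        = inj₂ (s≤s z≤n , inj₁ (s≤s a<b))
between-successor (step a<m) (step _)   wrap       (inj₂ (m<a , _))        = ⊥-elim (<-asym m<a a<m)
between-successor wrap       wrap       _          (inj₁ (m<m , _))        = ⊥-elim (<-irrefl refl m<m)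
between-successor wrap       wrap       wrap       (inj₂ (m<m , _))        = ⊥-elim (<-irrefl refl m<m)
between-successor wrap       wrap       (step _)   (inj₂ (_ , inj₁ m<m))   = ⊥-elim (<-irrefl refl m<m)
between-successor wrap       wrap       (step c<m) (inj₂ (_ , inj₂ m<c))   = ⊥-elim (<-asym m<c c<m)
between-successor wrap       (step _)   wrap       (inj₁ (m<b , b<m))      = ⊥-elim (<-asym m<b b<m)
between-successor wrap       (step _)   wrap       (inj₂ (m<m , _))        = ⊥-elim (<-irrefl refl m<m)
between-successor (step _)   wrap       wrap       (inj₁ (_ , m<m))        = ⊥-elim (<-irrefl refl m<m)
between-successor (step a<m) wrap       wrap       (inj₂ (m<a , _))        = ⊥-elim (<-asym m<a a<m)

between-predecessor : ∀ {m a b c a′ b′ c′} → Successor m a a′ → Successor m b b′ → Successor m c c′ →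
                      CyclicallyBetween a′ b′ c′ → CyclicallyBetween a b c
between-predecessor (step _)   (step _)   (step _)   (inj₁ (a<b , b<c))       = inj₁ (≤-pred a<b , ≤-pred b<c)
between-predecessor (step _)   (step _)   (step _)   (inj₂ (c<a , inj₁ a<b)) = inj₂ (≤-pred c<a , inj₁ (≤-pred a<b))
between-predecessor (step _)   (step _)   (step _)   (inj₂ (c<a , inj₂ b<c)) = inj₂ (≤-pred c<a , inj₂ (≤-pred b<c))
between-predecessor wrap       (step _)   (step c<m) (inj₁ (_ , b<c))         = inj₂ (c<m , inj₂ (≤-pred b<c))
between-predecessor wrap       (step _)   (step _)   (inj₂ (() , _))
between-predecessor (step _)   wrap       (step _)   (inj₁ (() , _))
between-predecessor (step a<m) wrap       (step _)   (inj₂ (c<a , _))         = inj₂ (≤-pred c<a , inj₁ a<m)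
between-predecessor (step _)   (step _)   wrap       (inj₁ (_ , ()))
between-predecessor (step _)   (step b<m) wrap       (inj₂ (_ , inj₁ a<b))   = inj₁ (≤-pred a<b , b<m)
between-predecessor (step _)   (step _)   wrap       (inj₂ (_ , inj₂ ()))
between-predecessor wrap       wrap       _          (inj₁ (() , _))
between-predecessor wrap       wrap       wrap       (inj₂ (() , _))
between-predecessor wrap       wrap       (step _)   (inj₂ (() , _))
between-predecessor wrap       (step _)   wrap       (inj₁ (_ , ()))
between-predecessor wrap       (step _)   wrap       (inj₂ (() , _))
between-predecessor (step _)   wrap       wrap       (inj₁ (() , _))
between-predecessor (step _)   wrap       wrap       (inj₂ (_ , inj₁ ()))
between-predecessor (step _)   wrap       wrap       (inj₂ (_ , inj₂ ()))

Successor-functional : ∀ {m a b b′} → Successor m a b → Successor m a b′ → b ≡ b′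
Successor-functional wrap       wrap     = refl
Successor-functional wrap       (step m<m) = ⊥-elim (<-irrefl refl m<m)
Successor-functional (step m<m) wrap     = ⊥-elim (<-irrefl refl m<m)
Successor-functional (step _)   (step _) = refl

Successor-injective : ∀ {m a a′ b} → Successor m a b → Successor m a′ b → a ≡ a′
Successor-injective wrap     wrap     = refl
Successor-injective (step _) (step _) = refl

Successor-2-cycle : ∀ {m a b} → Successor m a b → Successor m b a → m ≤ 1
Successor-2-cycle {zero} wrap _    = z≤n
Successor-2-cycle wrap     (step _) = ≤-refl
Successor-2-cycle (step _) wrap     = ≤-refl

module Rotation (m : ℕ) where

  rotate : Fin (suc m) → Fin (suc m)
  rotate i with m ℕ.≟ toℕ i
  ... | yes _   = zero
  ... | no m≢i = suc (lower₁ i m≢i)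

  unrotate : Fin (suc m) → Fin (suc m)
  unrotate zero    = fromℕ m
  unrotate (suc j) = inject₁ j

  rotate-successor : ∀ i → Successor m (toℕ i) (toℕ (rotate i))
  rotate-successor i with m ℕ.≟ toℕ i
  ... | yes m≡i = subst (λ a → Successor m a 0) m≡i wrap
  ... | no  m≢i = subst (Successor m (toℕ i)) (cong suc (sym (toℕ-lower₁ i m≢i)))
                        (step (≤∧≢⇒< (toℕ≤pred[n] i) (m≢i ∘ sym)))

  unrotate-successor : ∀ j → Successor m (toℕ (unrotate j)) (toℕ j)
  unrotate-successor zero    = subst (λ a → Successor m a 0) (sym (toℕ-fromℕ m)) wrap
  unrotate-successor (suc j) = subst (λ a → Successor m a (suc (toℕ j))) (sym (toℕ-inject₁ j)) (step (toℕ<n j))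

  rotate-unrotate : ∀ j → rotate (unrotate j) ≡ j
  rotate-unrotate j = toℕ-injective (Successor-functional (rotate-successor (unrotate j)) (unrotate-successor j))

  unrotate-rotate : ∀ i → unrotate (rotate i) ≡ i
  unrotate-rotate i = toℕ-injective (Successor-injective (unrotate-successor (rotate i)) (rotate-successor i))

  toℕ-unrotate : ∀ j → 0 < toℕ j → toℕ (unrotate j) ≡ ℕ.pred (toℕ j)
  toℕ-unrotate (suc j) _ = toℕ-inject₁ j

  rotate-injective : ∀ {i j} → rotate i ≡ rotate j → i ≡ j
  rotate-injective {i} {j} eq = trans (sym (unrotate-rotate i)) (trans (cong unrotate eq) (unrotate-rotate j))

  rotation : Permutation′ (suc m)
  rotation = permutation rotate unrotate rotate-unrotate unrotate-rotate

  CycSucc-rotate⁻ : ∀ {F p q} → CycSucc (preimage rotate F) p q → CycSucc F (rotate p) (rotate q)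
  CycSucc-rotate⁻ {F} {p} {q} pq with CycSucc⇒¬between pq
  ... | p≢q , no-between = ¬between⇒CycSucc (p≢q ∘ rotate-injective) λ r r∈ between →
    no-between (unrotate r) (∈preimage⁺ (subst (_∈ F) (sym (rotate-unrotate r)) r∈))
      (between-predecessor (rotate-successor p) (rotate-successor (unrotate r)) (rotate-successor q)
        (subst (λ r′ → CyclicallyBetween (toℕ (rotate p)) (toℕ r′) (toℕ (rotate q))) (sym (rotate-unrotate r)) between))

  CycSucc-rotate⁺ : ∀ {F p q} → CycSucc F (rotate p) (rotate q) → CycSucc (preimage rotate F) p q
  CycSucc-rotate⁺ {F} {p} {q} pq with CycSucc⇒¬between pq
  ... | p≢q , no-between = ¬between⇒CycSucc (p≢q ∘ cong rotate) λ r r∈ between →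
    no-between (rotate r) (∈preimage⁻ r∈)
      (between-successor (rotate-successor p) (rotate-successor r) (rotate-successor q) between)

  Consecutive-rotate⁻ : ∀ {F p q} → Consecutive (preimage rotate F) p q → Consecutive F (rotate p) (rotate q)
  Consecutive-rotate⁻ (p∈ , q∈ , pq) = ∈preimage⁻ p∈ , ∈preimage⁻ q∈ , map-⊎ CycSucc-rotate⁻ CycSucc-rotate⁻ pq

  Consecutive-rotate⁺ : ∀ {F p q} → Consecutive F (rotate p) (rotate q) → Consecutive (preimage rotate F) p q
  Consecutive-rotate⁺ (p∈ , q∈ , pq) = ∈preimage⁺ p∈ , ∈preimage⁺ q∈ , map-⊎ CycSucc-rotate⁺ CycSucc-rotate⁺ pq

  rotate-below : ∀ {i} → toℕ i < m → toℕ (rotate i) ≡ suc (toℕ i)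
  rotate-below {i} i<m = Successor-functional (rotate-successor i) (step i<m)

  rotate-top : ∀ {i} → toℕ i ≡ m → toℕ (rotate i) ≡ 0
  rotate-top {i} i≡m = Successor-functional (rotate-successor i) (subst (λ a → Successor m a 0) (sym i≡m) wrap)

  preimage-unrotate-rotate : ∀ F → preimage unrotate (preimage rotate F) ≡ F
  preimage-unrotate-rotate = preimage-inverse {f = rotate} {g = unrotate} rotate-unrotate

  preimage-rotate-unrotate : ∀ F → preimage rotate (preimage unrotate F) ≡ F
  preimage-rotate-unrotate = preimage-inverse {f = unrotate} {g = rotate} unrotate-rotate

  rotate-<-mono : ∀ {i j} → toℕ i < toℕ j → toℕ j < m → toℕ (rotate i) < toℕ (rotate j)
  rotate-<-mono i<j j<m = subst₂ _<_ (sym (rotate-below (<-trans i<j j<m))) (sym (rotate-below j<m)) (s≤s i<j)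

module RotatedEmbedding {m} {G : Graph (suc m)} (e : OuterplanarEmbedding G) where
  open Rotation m
  open Drawing e

  -- Position p of the rotated drawing carries the vertex at position p + 1 (mod m + 1) of e.
  rotated : OuterplanarEmbedding G
  rotated = record { ord = rotation ∘ₚ ord e ; noncrossing = rotated-noncrossing }
    where
    rotated-noncrossing : ∀ p q r s → E e (rotate p) (rotate q) → E e (rotate r) (rotate s) →
                          toℕ p < toℕ r → toℕ r < toℕ q → toℕ q < toℕ s → ⊥
    rotated-noncrossing p q r s Epq Ers p<r r<q q<s with m≤n⇒m<n∨m≡n (toℕ≤pred[n] s)
    ... | inj₁ s<m = crossing Epq Ers (rotate-<-mono p<r (<-trans r<q q<m)) (rotate-<-mono r<q q<m) (rotate-<-mono q<s s<m)
      where q<m = <-trans q<s s<m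
    ... | inj₂ s≡m = crossing (E-sym Ers) Epq
                       (subst (_< toℕ (rotate p)) (sym (rotate-top s≡m)) (subst (0 <_) (sym (rotate-below p<m)) (s≤s z≤n)))
                       (rotate-<-mono p<r r<m) (rotate-<-mono r<q q<m)
      -- after rotating, the chord r–s starts at position 0 and crosses p–q from the left
      where
      q<m = <-≤-trans q<s (≤-reflexive s≡m)
      r<m = <-trans r<q q<m
      p<m = <-trans p<r r<m

  private
    for-rotated : (P : Fin (suc m) → Fin (suc m) → Set) → (∀ p q → P (rotate p) (rotate q)) → ∀ p q → P p q
    for-rotated P h p q = subst₂ P (rotate-unrotate p) (rotate-unrotate q) (h (unrotate p) (unrotate q))

  IsFace-rotate⁺ : ∀ {F} → IsFace e F → IsFace rotated (preimage rotate F)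
  IsFace-rotate⁺ (3≤∣F∣ , side⇒E , E⇒side) =
    3≤∣preimage∣ {f = rotate} {g = unrotate} rotate-unrotate 3≤∣F∣ ,
    (λ p q pq → side⇒E _ _ (Consecutive-rotate⁻ pq)) ,
    (λ p q p∈ q∈ p≢q Epq → Consecutive-rotate⁺ (E⇒side _ _ (∈preimage⁻ p∈) (∈preimage⁻ q∈) (p≢q ∘ rotate-injective) Epq))

  IsFace-rotate⁻ : ∀ {F} → IsFace rotated (preimage rotate F) → IsFace e F
  IsFace-rotate⁻ {F} (3≤∣F′∣ , side⇒E , E⇒side) =
    subst (λ F → 3 ≤ ∣ F ∣) (preimage-unrotate-rotate F) (3≤∣preimage∣ {f = unrotate} {g = rotate} unrotate-rotate 3≤∣F′∣) ,
    for-rotated (λ p q → Consecutive F p q → E e p q) (λ p q pq → side⇒E p q (Consecutive-rotate⁺ pq)) ,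
    for-rotated (λ p q → p ∈ F → q ∈ F → p ≢ q → E e p q → Consecutive F p q)
      (λ p q p∈ q∈ p≢q Epq → Consecutive-rotate⁻ (E⇒side p q (∈preimage⁺ p∈) (∈preimage⁺ q∈) (p≢q ∘ cong rotate) Epq))

  DualAdj-rotate⁺ : ∀ {F H} → DualAdj e F H → DualAdj rotated (preimage rotate F) (preimage rotate H)
  DualAdj-rotate⁺ {F} {H} (F-face , H-face , F≢H , x , y , x≢y , Exy , x-y∈F , x-y∈H) =
    IsFace-rotate⁺ F-face , IsFace-rotate⁺ H-face ,
    (λ eq → F≢H (trans (sym (preimage-unrotate-rotate F)) (trans (cong (preimage unrotate) eq) (preimage-unrotate-rotate H)))) ,
    unrotate x , unrotate y , (λ eq → x≢y (trans (sym (rotate-unrotate x)) (trans (cong rotate eq) (rotate-unrotate y)))) ,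
    subst₂ (E e) (sym (rotate-unrotate x)) (sym (rotate-unrotate y)) Exy ,
    Consecutive-rotate⁺ (subst₂ (Consecutive F) (sym (rotate-unrotate x)) (sym (rotate-unrotate y)) x-y∈F) ,
    Consecutive-rotate⁺ (subst₂ (Consecutive H) (sym (rotate-unrotate x)) (sym (rotate-unrotate y)) x-y∈H)

  DualAdj-rotate⁻ : ∀ {F H} → DualAdj rotated (preimage rotate F) (preimage rotate H) → DualAdj e F H
  DualAdj-rotate⁻ (F-face , H-face , F≢H , x , y , x≢y , Exy , x-y∈F , x-y∈H) =
    IsFace-rotate⁻ F-face , IsFace-rotate⁻ H-face , F≢H ∘ cong (preimage rotate) ,
    rotate x , rotate y , x≢y ∘ rotate-injective , Exy , Consecutive-rotate⁻ x-y∈F , Consecutive-rotate⁻ x-y∈H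

  IsLeaf-unrotate : ∀ {Λ} → IsLeaf rotated Λ → IsLeaf e (preimage unrotate Λ)
  IsLeaf-unrotate {Λ} (Λ-face , N , Λ-N , N-unique) =
    IsFace-rotate⁻ (subst (IsFace rotated) (sym Λ≡) Λ-face) , preimage unrotate N ,
    DualAdj-rotate⁻ (subst₂ (DualAdj rotated) (sym Λ≡) (sym (preimage-rotate-unrotate N)) Λ-N) ,
    λ H Λ-H → trans (sym (preimage-unrotate-rotate H))
                    (cong (preimage unrotate) (N-unique (preimage rotate H)
                                 (subst (λ F → DualAdj rotated F (preimage rotate H)) Λ≡ (DualAdj-rotate⁺ Λ-H))))
    where
    Λ≡ : preimage rotate (preimage unrotate Λ) ≡ Λ
    Λ≡ = preimage-rotate-unrotate Λ

module IteratedRotation {m} {G : Graph (suc m)} where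
  open Rotation m

  rotateⁿ unrotateⁿ : ℕ → Fin (suc m) → Fin (suc m)
  rotateⁿ zero    i = i
  rotateⁿ (suc k) i = rotateⁿ k (rotate i)
  unrotateⁿ zero    i = i
  unrotateⁿ (suc k) i = unrotate (unrotateⁿ k i)

  unrotateⁿ-rotateⁿ : ∀ k i → unrotateⁿ k (rotateⁿ k i) ≡ i
  unrotateⁿ-rotateⁿ zero    i = refl
  unrotateⁿ-rotateⁿ (suc k) i = trans (cong unrotate (unrotateⁿ-rotateⁿ k (rotate i))) (unrotate-rotate i)

  preimage-unrotateⁿ-injective : ∀ k {F H} → preimage (unrotateⁿ k) F ≡ preimage (unrotateⁿ k) H → F ≡ H
  preimage-unrotateⁿ-injective k {F} {H} eq =
    trans (sym (inverse F)) (trans (cong (preimage (rotateⁿ k)) eq) (inverse H))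
    where inverse = preimage-inverse {f = unrotateⁿ k} {g = rotateⁿ k} (unrotateⁿ-rotateⁿ k)

  toℕ-unrotateⁿ : ∀ k i → k ≤ toℕ i → toℕ (unrotateⁿ k i) ≡ toℕ i ∸ k
  toℕ-unrotateⁿ zero    i _   = refl
  toℕ-unrotateⁿ (suc k) i k<i =
    let IH = toℕ-unrotateⁿ k i (<⇒≤ k<i)
    in trans (toℕ-unrotate (unrotateⁿ k i) (subst (0 <_) (sym IH) (m<n⇒0<n∸m k<i)))
             (trans (cong ℕ.pred IH) (pred[m∸n]≡m∸[1+n] (toℕ i) k))

  rotatedⁿ : ℕ → OuterplanarEmbedding G → OuterplanarEmbedding G
  rotatedⁿ zero    e = e
  rotatedⁿ (suc k) e = RotatedEmbedding.rotated (rotatedⁿ k e)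

  IsLeaf-unrotateⁿ : ∀ k {e Λ} → IsLeaf (rotatedⁿ k e) Λ → IsLeaf e (preimage (unrotateⁿ k) Λ)
  IsLeaf-unrotateⁿ zero    {e} {Λ} Λ-leaf = subst (IsLeaf e) (sym (preimage-id Λ)) Λ-leaf
  IsLeaf-unrotateⁿ (suc k) {e} {Λ} Λ-leaf =
    subst (IsLeaf e) (preimage-∘ unrotate (unrotateⁿ k) Λ)
          (IsLeaf-unrotateⁿ k (RotatedEmbedding.IsLeaf-unrotate (rotatedⁿ k e) Λ-leaf))

module OuterCycleNeighbours {m} {G : Graph (suc m)} (e : OuterplanarEmbedding G) (2-conn : TwoConnected G) where
  open Drawing e
  open OuterCycle e 2-conn
  open Rotation m

  E-rotate : ∀ p → E e p (rotate p)
  E-rotate p with m≤n⇒m<n∨m≡n (toℕ≤pred[n] p)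
  ... | inj₁ p<m = successor-adjacent p (rotate p) (rotate-below p<m)
  ... | inj₂ p≡m = E-sym (ends-adjacent (rotate p) p (rotate-top p≡m) (cong suc p≡m))

  two-neighbours : ∀ v → ∃₂ λ w₁ w₂ → v ∼[ G ] w₁ × v ∼[ G ] w₂ × w₁ ≢ w₂
  two-neighbours v =
    let p = positionOf v
        v∼ : ∀ {q} → E e p q → v ∼[ G ] vertexAt q
        v∼ = subst (λ u → u ∼[ G ] _) (vertexAt-positionOf v)
    in vertexAt (rotate p) , vertexAt (unrotate p) , v∼ (E-rotate p) ,
       v∼ (E-sym (subst (E e (unrotate p)) (rotate-unrotate p) (E-rotate (unrotate p)))) ,
       λ eq → <⇒≱ (proj₁ 2-conn)
                (s≤s (Successor-2-cycle (rotate-successor p)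
                       (subst (λ q → Successor m (toℕ q) (toℕ p)) (sym (vertexAt-injective eq)) (unrotate-successor p))))

-- Zero forcing

module _ {n} (G : Graph n) where

  ∼-irrefl : ∀ {u v} → u ∼[ G ] v → u ≢ v
  ∼-irrefl {u} u∼u refl = subst Bool.T (irrefl G u) u∼u

  two-neighbours⇒2≤∣ZeroForcingSet∣ : (∀ v → ∃₂ λ w₁ w₂ → v ∼[ G ] w₁ × v ∼[ G ] w₂ × w₁ ≢ w₂) →
                                      Fin n → ∀ S → IsZeroForcingSet G S → 2 ≤ ∣ S ∣
  two-neighbours⇒2≤∣ZeroForcingSet∣ two-neighbours v₀ S all-blue with 2 ≤? ∣ S ∣
  ... | yes 2≤∣S∣ = 2≤∣S∣
  ... | no  2≰∣S∣ =
    let w , _ , v₀∼w , _ = two-neighbours v₀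
    in x≢y⇒2≤∣p∣ (∼-irrefl v₀∼w) (blue⇒∈ (all-blue v₀)) (blue⇒∈ (all-blue w))
    -- with fewer than two initial blue vertices no force is possible: the forcing vertex has a second blue neighbour
    where
    blue⇒∈ : ∀ {v} → Blue G S v → v ∈ S
    blue⇒∈ (init v∈S) = v∈S
    blue⇒∈ (force {u} {v} u-blue u∼v others-blue) with two-neighbours u
    ... | w₁ , w₂ , u∼w₁ , u∼w₂ , w₁≢w₂ with w₁ ≟ᶠ v
    ...   | no  w₁≢v = ⊥-elim (2≰∣S∣ (x≢y⇒2≤∣p∣ (∼-irrefl u∼w₁) (blue⇒∈ u-blue)
                                                  (blue⇒∈ (others-blue w₁ u∼w₁ w₁≢v))))
    ...   | yes refl = ⊥-elim (2≰∣S∣ (x≢y⇒2≤∣p∣ (∼-irrefl u∼w₂) (blue⇒∈ u-blue)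
                                                  (blue⇒∈ (others-blue w₂ u∼w₂ (w₁≢w₂ ∘ sym)))))

module Sweep {m} {G : Graph (suc m)} (e : OuterplanarEmbedding G)
             (successor-adjacent : ∀ p q → toℕ q ≡ suc (toℕ p) → E e p q)
             (no-separated : ¬ Faces.SeparatedLongEdges e) where
  open Drawing e

  ends : Subset (suc m)
  ends = ⁅ vertexAt zero ⁆ ∪ ⁅ vertexAt (fromℕ m) ⁆

  private
    BlueUpTo BlueFrom : Fin (suc m) → Set
    BlueUpTo l = ∀ x → toℕ x ≤ toℕ l → Blue G ends (vertexAt x)
    BlueFrom r = ∀ x → toℕ r ≤ toℕ x → Blue G ends (vertexAt x)

    ∼⇒E-at : ∀ {p w} → vertexAt p ∼[ G ] w → E e p (positionOf w)
    ∼⇒E-at {p} p∼w = subst (λ q → E e q _) (positionOf-vertexAt p) (∼⇒E p∼w)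

    forces : ∀ {p q} → Blue G ends (vertexAt p) → E e p q →
             (∀ x → E e p x → x ≢ q → Blue G ends (vertexAt x)) → Blue G ends (vertexAt q)
    forces {p} {q} p-blue Epq others = force p-blue Epq λ w p∼w w≢q →
      subst (Blue G ends) (vertexAt-positionOf w)
        (others (positionOf w) (∼⇒E-at p∼w) λ w′≡q → w≢q (trans (sym (vertexAt-positionOf w)) (cong vertexAt w′≡q)))

    forward : ∀ l r l′ → toℕ l′ ≡ suc (toℕ l) → toℕ l′ < toℕ r → BlueUpTo l → BlueFrom r →
              ¬ (∃ λ a → suc (toℕ l) < toℕ a × toℕ a < toℕ r × E e l a) → Blue G ends (vertexAt l′)
    forward l r l′ l′≡1+l l′<r up-to-l from-r no-chord =
      forces (up-to-l l ≤-refl) (successor-adjacent l l′ l′≡1+l) blue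
      where
      blue : ∀ x → E e l x → x ≢ l′ → Blue G ends (vertexAt x)
      blue x Elx x≢l′ with toℕ x ≤? toℕ l | toℕ r ≤? toℕ x
      ... | yes x≤l | _        = up-to-l x x≤l
      ... | no  _   | yes r≤x = from-r x r≤x
      ... | no  x≰l | no  r≰x with m≤n⇒m<n∨m≡n (≰⇒> x≰l)
      ...   | inj₂ 1+l≡x = ⊥-elim (x≢l′ (toℕ-injective (trans (sym 1+l≡x) (sym l′≡1+l))))
      ...   | inj₁ 1+l<x = ⊥-elim (no-chord (x , 1+l<x , ≰⇒> r≰x , Elx))

    backward : ∀ l r r′ → suc (toℕ r′) ≡ toℕ r → toℕ l < toℕ r′ → BlueUpTo l → BlueFrom r →
               ¬ (∃ λ b → toℕ l < toℕ b × suc (toℕ b) < toℕ r × E e b r) → Blue G ends (vertexAt r′)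
    backward l r r′ 1+r′≡r l<r′ up-to-l from-r no-chord =
      forces (from-r r ≤-refl) (E-sym (successor-adjacent r′ r (sym 1+r′≡r))) blue
      where
      blue : ∀ x → E e r x → x ≢ r′ → Blue G ends (vertexAt x)
      blue x Erx x≢r′ with toℕ r ≤? toℕ x | toℕ x ≤? toℕ l
      ... | yes r≤x | _        = from-r x r≤x
      ... | no  _   | yes x≤l = up-to-l x x≤l
      ... | no  r≰x | no  x≰l with m≤n⇒m<n∨m≡n (≰⇒> r≰x)
      ...   | inj₂ 1+x≡r = ⊥-elim (x≢r′ (toℕ-injective (suc-injective (trans 1+x≡r (sym 1+r′≡r)))))
      ...   | inj₁ 1+x<r = ⊥-elim (no-chord (x , ≰⇒> x≰l , 1+x<r , E-sym Erx))

    2+l≤r : ∀ k (l r : Fin (suc m)) → toℕ r ≡ toℕ l + suc (suc k) → suc (suc (toℕ l)) ≤ toℕ r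
    2+l≤r k l r r≡l+2+k = subst (suc (suc (toℕ l)) ≤_) (sym r≡l+2+k)
      (subst (_≤ toℕ l + suc (suc k)) (+-comm (toℕ l) 2) (+-monoʳ-≤ (toℕ l) (s≤s (s≤s z≤n))))

    sweep : ∀ k l r → toℕ r ≡ toℕ l + suc k → BlueUpTo l → BlueFrom r → ∀ x → Blue G ends (vertexAt x)
    sweep zero l r r≡1+l up-to-l from-r x with toℕ x ≤? toℕ l
    ... | yes x≤l = up-to-l x x≤l
    ... | no  x≰l = from-r x (subst (_≤ toℕ x) (sym (trans r≡1+l (+-comm (toℕ l) 1))) (≰⇒> x≰l))
    sweep (suc k) l r r≡l+2+k up-to-l from-r
      with any? (λ a → (suc (toℕ l) <? toℕ a) ×-dec (toℕ a <? toℕ r) ×-dec E? l a)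
         | any? (λ b → (toℕ l <? toℕ b) ×-dec (suc (toℕ b) <? toℕ r) ×-dec E? b r)
    ... | yes (a , 1+l<a , a<r , Ela) | yes (b , l<b , 1+b<r , Ebr) with <-cmp (toℕ b) (toℕ a)
    ...   | tri< b<a _ _ = ⊥-elim (crossing Ela Ebr l<b b<a a<r)
    ...   | tri≈ _ b≡a _ = ⊥-elim (no-separated (l , a , b , r , (Ela , 1+l<a) , (Ebr , 1+b<r) , ≤-reflexive (sym b≡a)))
    ...   | tri> _ _ a<b = ⊥-elim (no-separated (l , a , b , r , (Ela , 1+l<a) , (Ebr , 1+b<r) , <⇒≤ a<b))
    sweep (suc k) l r r≡l+2+k up-to-l from-r | no no-chord | _ =
      let l′ , l′≡1+l = next {x = l} {r} (<-trans (n<1+n _) (2+l≤r k l r r≡l+2+k))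
      in sweep k l′ r (trans r≡l+2+k (trans (+-suc (toℕ l) (suc k)) (cong (_+ suc k) (sym l′≡1+l))))
           (λ x x≤l′ → [ (λ x<l′ → up-to-l x (≤-pred (subst (toℕ x <_) l′≡1+l x<l′)))
                       , (λ x≡l′ → subst (Blue G ends ∘ vertexAt) (sym (toℕ-injective x≡l′))
                                     (forward l r l′ l′≡1+l (subst (_< toℕ r) (sym l′≡1+l) (2+l≤r k l r r≡l+2+k))
                                              up-to-l from-r no-chord)) ]′ (m≤n⇒m<n∨m≡n x≤l′))
           from-r
    sweep (suc k) l r r≡l+2+k up-to-l from-r | yes _ | no no-chord =
      let r′<r : toℕ l + suc k < toℕ r
          r′<r = subst (toℕ l + suc k <_) (sym r≡l+2+k) (+-monoʳ-< (toℕ l) (n<1+n (suc k)))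
          r′ = fromℕ< (<-trans r′<r (toℕ<n r))
          r′≡l+1+k = toℕ-fromℕ< (<-trans r′<r (toℕ<n r))
          1+r′≡r = trans (cong suc r′≡l+1+k) (trans (sym (+-suc (toℕ l) (suc k))) (sym r≡l+2+k))
      in sweep k l r′ r′≡l+1+k up-to-l
           (λ x r′≤x → [ (λ r′<x → from-r x (subst (_≤ toℕ x) 1+r′≡r r′<x))
                       , (λ r′≡x → subst (Blue G ends ∘ vertexAt) (toℕ-injective r′≡x)
                                     (backward l r r′ 1+r′≡r (subst (toℕ l <_) (sym r′≡l+1+k) (m<m+n (toℕ l) (s≤s z≤n)))
                                               up-to-l from-r no-chord)) ]′ (m≤n⇒m<n∨m≡n r′≤x))

  ∣ends∣≡2 : 0 < m → ∣ ends ∣ ≡ 2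
  ∣ends∣≡2 0<m = x≢y⇒∣⁅x⁆∪⁅y⁆∣≡2 λ eq → <⇒≢ 0<m (trans (cong toℕ (vertexAt-injective eq)) (toℕ-fromℕ m))

  ends-forcing : 0 < m → IsZeroForcingSet G ends
  ends-forcing 0<m v = subst (Blue G ends) (vertexAt-positionOf v)
    (sweep (m ∸ 1) zero (fromℕ m) (trans (toℕ-fromℕ m) (sym (trans (+-comm 1 (m ∸ 1)) (m∸n+n≡m 0<m))))
           (λ x x≤0 → subst (Blue G ends ∘ vertexAt) (sym (toℕ-injective (n≤0⇒n≡0 x≤0)))
                        (init (x∈p∪q⁺ (inj₁ (x∈⁅x⁆ _)))))
           (λ x m≤x → subst (Blue G ends ∘ vertexAt)
                        (toℕ-injective (trans (toℕ-fromℕ m) (≤-antisym (subst (_≤ toℕ x) (toℕ-fromℕ m) m≤x) (toℕ≤pred[n] x))))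
                        (init (x∈p∪q⁺ (inj₂ (x∈⁅x⁆ _)))))
           (positionOf v))

module Unseparated {m} {G : Graph (suc m)} (e : OuterplanarEmbedding G) (2-conn : TwoConnected G) where
  open Rotation m
  open IteratedRotation {G = G}
  open Faces using (LongEdge; LongEdge?; SeparatedLongEdges)

  private
    <m⇒NotTop : ∀ {l a : Fin (suc m)} → toℕ a < m → NotTop l a
    <m⇒NotTop a<m = inj₂ (s≤s a<m)

    separated⇒<m : ∀ {f : OuterplanarEmbedding G} {a b r : Fin (suc m)} → LongEdge f b r → toℕ a ≤ toℕ b → toℕ a < m
    separated⇒<m br a≤b = ≤-<-trans a≤b (<-≤-trans (<-trans (n<1+n _) (proj₂ br)) (toℕ≤pred[n] _))

  unseparated-rotation : ExactlyTwoLeaves e → ∃ λ k → ¬ SeparatedLongEdges (rotatedⁿ k e)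
  unseparated-rotation two-leaves
    with any? (λ u → any? (λ v → LongEdge? e u v ×-dec ((0 <? toℕ u) ⊎-dec (suc (toℕ v) <? suc m))))
  ... | no no-inner-chord = 0 , λ (l , a , b , r , la , br , a≤b) →
          no-inner-chord (l , a , la , <m⇒NotTop (separated⇒<m {e} br a≤b))
  ... | yes (u , v , uv , uv-not-top) = suc (toℕ y) , no-separated
    -- rotate the outer edge y–y′ of a leaf to the top; the leaves under two separated chords are then new ones
    where
    open Leaves.LeafUnder (Leaves.leaf-under e 2-conn uv uv-not-top)
      renaming (leaf to Λ₀; isLeaf to Λ₀-leaf; corner to y; next-corner to y′; corner∈ to y∈; next-corner∈ to y′∈)
    k = suc (toℕ y)

    y-goes-last : toℕ (unrotateⁿ k y) ≡ m
    y-goes-last = trans (cong (toℕ ∘ unrotate) (toℕ-injective {j = zero}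
                          (trans (toℕ-unrotateⁿ (toℕ y) y ≤-refl) (n∸n≡0 (toℕ y)))))
                        (toℕ-fromℕ m)

    y′-goes-first : toℕ (unrotateⁿ k y′) ≡ 0
    y′-goes-first = trans (toℕ-unrotateⁿ k y′ (≤-reflexive (sym next-corner≡1+)))
                          (trans (cong (_∸ k) next-corner≡1+) (n∸n≡0 k))

    no-separated : ¬ SeparatedLongEdges (rotatedⁿ k e)
    no-separated (l , a , b , r , la , br , a≤b) =
      no-three-leaves {e = e} two-leaves Λ₀-leaf (IsLeaf-unrotateⁿ k {e} Λ₁.isLeaf) (IsLeaf-unrotateⁿ k {e} Λ₂.isLeaf)
        Λ₀≢Λ₁ Λ₀≢Λ₂ (Λ₁≢Λ₂ ∘ preimage-unrotateⁿ-injective k)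
      where
      a<m = separated⇒<m {rotatedⁿ k e} br a≤b
      0<b = ≤-trans (s≤s z≤n) (≤-trans (proj₂ la) a≤b)
      module Λ₁ = Leaves.LeafUnder (Leaves.leaf-under (rotatedⁿ k e) 2-conn la (<m⇒NotTop a<m))
      module Λ₂ = Leaves.LeafUnder (Leaves.leaf-under (rotatedⁿ k e) 2-conn br (inj₁ 0<b))

      Λ₁≢Λ₂ : Λ₁.leaf ≢ Λ₂.leaf
      Λ₁≢Λ₂ eq = <⇒≱ (<-≤-trans Λ₁.next-corner<a a≤b)
                     (proj₁ (Λ₂.within _ (subst (Λ₁.next-corner ∈_) eq Λ₁.next-corner∈)))

      Λ₀≢Λ₁ : Λ₀ ≢ preimage (unrotateⁿ k) Λ₁.leaf
      Λ₀≢Λ₁ eq = <⇒≱ a<m (subst (_≤ toℕ a) y-goes-last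
                   (proj₂ (Λ₁.within _ (∈preimage⁻ (subst (y ∈_) eq y∈)))))

      Λ₀≢Λ₂ : Λ₀ ≢ preimage (unrotateⁿ k) Λ₂.leaf
      Λ₀≢Λ₂ eq = <⇒≱ 0<b (subst (toℕ b ≤_) y′-goes-first
                   (proj₁ (Λ₂.within _ (∈preimage⁻ (subst (y′ ∈_) eq y′∈)))))

corollary1 : ∀ {n} (G : Graph n) (e : OuterplanarEmbedding G) →
    TwoConnected G → ExactlyTwoLeaves e →
    ZeroForcingNumberIs G 2
corollary1 {zero}  G e (() , _) _
corollary1 {suc m} G e 2-conn two-leaves =
  let k , unseparated = Unseparated.unseparated-rotation e 2-conn two-leaves
      e′ = IteratedRotation.rotatedⁿ k e
      open Sweep e′ (OuterCycle.successor-adjacent e′ 2-conn) unseparated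
      0<m = ≤-trans (s≤s z≤n) (≤-pred (proj₁ 2-conn))
  in (ends , ∣ends∣≡2 0<m , ends-forcing 0<m) ,
     two-neighbours⇒2≤∣ZeroForcingSet∣ G (OuterCycleNeighbours.two-neighbours e 2-conn) zero
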